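{- The polytope $P_n(132,312)$ is a rectangular parallelepiped (parallelotope). Specifically, the polytope is contained in the hyperplane $\sum x_i = \binom{n+1}{2}$, and its facet-defining inequalities are \[ \left| \sum_{i=1}^j (x_i - x_{j+1}) \right| \leq \binom{j+1}{2} \] as $j$ ranges over $1,\ldots, n-1$.
   Context: $P_n(132,312)=\operatorname{conv}\{(a_1,\dots,a_n)\in\mathbb{R}^n : a_1\cdots a_n\in\mathfrak{S}_n$ avoids both patterns $132$ and $312\}$, where a permutation avoids a pattern if it has no substring whose elements are in the same relative order as the pattern.
   Formalization: Points of $P_n(132,312)$, of the hyperplane and of the faces lie in ℚ^n rather than ℝ^n, convex combinations have rational weights, and dimensions count affinely independent rational points. -}

module Defs where

open import Data.Nat as ℕ using (ℕ; zero; suc; _<ᵇ_)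
open import Data.Nat.Combinatorics using (_C_)
open import Data.Fin as Fin using (Fin; toℕ)
open import Data.Integer using (+_)
open import Data.Rational using (ℚ; 0ℚ; 1ℚ; _+_; _*_; _-_; _≤_; _/_)
open import Data.Bool using (if_then_else_)
open import Data.Product using (Σ; ∃; _×_)
open import Relation.Nullary using (¬_)
open import Relation.Binary.PropositionalEquality using (_≡_)
open import Function.Definitions using (Injective)

-- points of ℚ^n (0-based coordinates: x i is the paper's x_{i+1})
Pt : ℕ → Set
Pt n = Fin n → ℚ

ΣF : ∀ {n} → (Fin n → ℚ) → ℚ
ΣF {zero} f = 0ℚ
ΣF {suc n} f = f Fin.zero + ΣF (λ i → f (Fin.suc i))

ℕ→ℚ : ℕ → ℚ
ℕ→ℚ m = (+ m) / 1

-- a permutation of [n], as an injective map Fin n → Fin n; the one-line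
-- notation a_1 ... a_n has a_{i+1} = toℕ (σ i) + 1
Perm : ℕ → Set
Perm n = Σ (Fin n → Fin n) (λ σ → Injective _≡_ _≡_ σ)

Avoids132 : ∀ {n} → (Fin n → Fin n) → Set
Avoids132 {n} σ = ¬ (Σ (Fin n) λ i → Σ (Fin n) λ j → Σ (Fin n) λ k →
  (i Fin.< j) × (j Fin.< k) × (σ i Fin.< σ k) × (σ k Fin.< σ j))

Avoids312 : ∀ {n} → (Fin n → Fin n) → Set
Avoids312 {n} σ = ¬ (Σ (Fin n) λ i → Σ (Fin n) λ j → Σ (Fin n) λ k →
  (i Fin.< j) × (j Fin.< k) × (σ j Fin.< σ k) × (σ k Fin.< σ i))

permPt : ∀ {n} → (Fin n → Fin n) → Pt n
permPt σ i = ℕ→ℚ (suc (toℕ (σ i)))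

Vert : (n : ℕ) → Pt n → Set
Vert n x = Σ (Perm n) λ σ → Avoids132 (Σ.proj₁ σ) × Avoids312 (Σ.proj₁ σ)
             × (permPt (Σ.proj₁ σ) ≡ x)
  where open Data.Product

Conv : ∀ {n} → (Pt n → Set) → Pt n → Set
Conv {n} S x = Σ ℕ λ m → Σ (Fin m → ℚ) λ w → Σ (Fin m → Pt n) λ p →
  (∀ i → S (p i)) × (∀ i → 0ℚ ≤ w i) × (ΣF w ≡ 1ℚ)
  × (∀ t → ΣF (λ i → w i * p i t) ≡ x t)

P : (n : ℕ) → Pt n → Set
P n = Conv (Vert n)

-- for k with toℕ k = j (1 ≤ j ≤ n-1):  L k x = Σ_{i=1}^{j} (x_i - x_{j+1})
L : ∀ {n} → Fin n → Pt n → ℚ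
L k x = ΣF (λ i → if toℕ i <ᵇ toℕ k then x i - x k else 0ℚ)

e : ∀ {n} → Fin n → Pt n
e i t = if (toℕ i ℕ.≡ᵇ toℕ t) then 1ℚ else 0ℚ

AffInd : ∀ {m n} → (Fin m → Pt n) → Set
AffInd {m} {n} p = ∀ (c : Fin m → ℚ) → ΣF c ≡ 0ℚ →
  (∀ t → ΣF (λ i → c i * p i t) ≡ 0ℚ) → ∀ i → c i ≡ 0ℚ

HasDim : ∀ {n} → (Pt n → Set) → ℕ → Set
HasDim {n} A d =
  (Σ (Fin (suc d) → Pt n) λ p → (∀ i → A (p i)) × AffInd p)
  × ¬ (Σ (Fin (suc (suc d)) → Pt n) λ p → (∀ i → A (p i)) × AffInd p)

Face⁺ : ∀ n → Fin n → Pt n → Set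
Face⁺ n k x = P n x × (L k x ≡ ℕ→ℚ (suc (toℕ k) C 2))

Face⁻ : ∀ n → Fin n → Pt n → Set
Face⁻ n k x = P n x × (Data.Rational.-_ (L k x) ≡ ℕ→ℚ (suc (toℕ k) C 2))

{-# OPTIONS --safe #-}
-- Each prefix of a permutation avoiding 132 and 312 consists of consecutive values, so the
-- vertices are built by appending, step by step, either a new maximum or a new minimum.
-- Hence every vertex has coordinate sum C(n+1,2) and L_j = ±C(j+1,2), and so does every
-- point of P. Conversely, a point x of ℚ^(n+1) satisfying these constraints is the convex
-- combination λ (u, n+1) + (1-λ) (u+1, 1), λ = (x_{n+1} - 1)/n, of the two extensions of
-- a point u of ℚ^n satisfying them, so x ∈ P by induction. The same two extensions produce
-- enough affinely independent points in P and in each facet; conversely the coordinate sum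
-- (and on a facet also L_j) is constant, so in an affine dependency one coordinate (two on a
-- facet) is determined by the others, which bounds the dimension.
module Submission where

open import Defs
open import Data.Nat using (ℕ; suc; _∸_)
open import Data.Nat.Combinatorics using (_C_)
open import Data.Fin using (Fin; toℕ)
open import Data.Rational using (ℚ; 0ℚ; _*_; ∣_∣; _≤_)
open import Data.Product using (_×_)
open import Relation.Binary.PropositionalEquality using (_≡_; _≢_)
open import Function.Bundles using (_⇔_)

open import Data.Bool using (Bool; true; false; if_then_else_)
open import Data.Empty using (⊥; ⊥-elim)
open import Data.Fin as Fin using (zero; suc; inject₁; fromℕ; punchIn; punchOut)
import Data.Fin.Properties as Finₚ
open import Data.Fin.Relation.Unary.Top using (view; ‵fromℕ; ‵inj₁)
import Data.Integer as ℤ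
import Data.Integer.Properties as ℤₚ
open import Data.Nat as ℕ using (zero; _<ᵇ_; _≡ᵇ_)
open import Data.Nat.Combinatorics using (nC1≡n; nCk+nC[k+1]≡[n+1]C[k+1])
import Data.Nat.Coprimality as Coprime
import Data.Nat.Properties as ℕₚ
import Data.Nat.Tactic.RingSolver as ℕ-Solver
open import Data.Product using (Σ; ∃-syntax; _,_; proj₁; proj₂)
open import Data.Rational
  using (1ℚ; _+_; _-_; -_; mkℚ; toℚᵘ; 1/_; Positive; nonNegative; ≢-nonZero)
open import Data.Rational.Properties
import Data.Rational.Unnormalised as ℚᵘ
import Data.Rational.Unnormalised.Properties as ℚᵘₚ
open import Data.Sum using (_⊎_; inj₁; inj₂; [_,_]′)
open import Function.Bundles using (mk⇔)
open import Function.Definitions using (Injective)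
open import Level using (0ℓ)
open import Relation.Binary.Definitions using (tri<; tri≈; tri>)
open import Relation.Binary.PropositionalEquality
  using (refl; sym; trans; cong; cong₂; subst; subst₂; _≗_; module ≡-Reasoning)
open import Relation.Nullary using (¬_; yes; no; ¬?)
open import Relation.Nullary.Decidable using (dec⇒maybe; decidable-stable)
open import Tactic.RingSolver using (solve-∀)
open import Tactic.RingSolver.Core.AlmostCommutativeRing
  using (AlmostCommutativeRing; fromCommutativeRing)

ℚ-ring : AlmostCommutativeRing 0ℓ 0ℓ
ℚ-ring = fromCommutativeRing +-*-commutativeRing (λ q → dec⇒maybe (0ℚ ≟ q))

ℕ→ℚ≡mkℚ : ∀ m → ℕ→ℚ m ≡ mkℚ (ℤ.+ m) 0 (Coprime.sym (Coprime.1-coprimeTo m))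
ℕ→ℚ≡mkℚ m = normalize-coprime (Coprime.sym (Coprime.1-coprimeTo m))

ℕ→ℚ-suc : ∀ m → ℕ→ℚ (suc m) ≡ 1ℚ + ℕ→ℚ m
ℕ→ℚ-suc m = toℚᵘ-injective (ℚᵘₚ.≃-trans cast (ℚᵘₚ.≃-sym (toℚᵘ-homo-+ 1ℚ (ℕ→ℚ m))))
  where
  numerators : ℤ.+ suc m ≡ ℤ.+ 1 ℤ.* ℤ.+ 1 ℤ.+ ℤ.+ m ℤ.* ℤ.+ 1
  numerators rewrite ℕₚ.*-identityʳ m | ℤₚ.+◃n≡+n m = refl
  cast : toℚᵘ (ℕ→ℚ (suc m)) ℚᵘ.≃ toℚᵘ 1ℚ ℚᵘ.+ toℚᵘ (ℕ→ℚ m)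
  cast rewrite ℕ→ℚ≡mkℚ (suc m) | ℕ→ℚ≡mkℚ m = ℚᵘ.*≡* (cong (ℤ._* ℤ.+ 1) numerators)

ℕ→ℚ-+ : ∀ m n → ℕ→ℚ (m ℕ.+ n) ≡ ℕ→ℚ m + ℕ→ℚ n
ℕ→ℚ-+ zero n = sym (+-identityˡ (ℕ→ℚ n))
ℕ→ℚ-+ (suc m) n = begin
  ℕ→ℚ (suc (m ℕ.+ n))       ≡⟨ ℕ→ℚ-suc (m ℕ.+ n) ⟩
  1ℚ + ℕ→ℚ (m ℕ.+ n)        ≡⟨ cong (1ℚ +_) (ℕ→ℚ-+ m n) ⟩
  1ℚ + (ℕ→ℚ m + ℕ→ℚ n)      ≡⟨ +-assoc 1ℚ (ℕ→ℚ m) (ℕ→ℚ n) ⟨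
  (1ℚ + ℕ→ℚ m) + ℕ→ℚ n      ≡⟨ cong (_+ ℕ→ℚ n) (ℕ→ℚ-suc m) ⟨
  ℕ→ℚ (suc m) + ℕ→ℚ n       ∎
  where open ≡-Reasoning

ℕ→ℚ-* : ∀ m n → ℕ→ℚ (m ℕ.* n) ≡ ℕ→ℚ m * ℕ→ℚ n
ℕ→ℚ-* zero n = sym (*-zeroˡ (ℕ→ℚ n))
ℕ→ℚ-* (suc m) n = begin
  ℕ→ℚ (n ℕ.+ m ℕ.* n)           ≡⟨ ℕ→ℚ-+ n (m ℕ.* n) ⟩
  ℕ→ℚ n + ℕ→ℚ (m ℕ.* n)         ≡⟨ cong (ℕ→ℚ n +_) (ℕ→ℚ-* m n) ⟩
  ℕ→ℚ n + ℕ→ℚ m * ℕ→ℚ n         ≡⟨ distrib (ℕ→ℚ m) (ℕ→ℚ n) ⟩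
  (1ℚ + ℕ→ℚ m) * ℕ→ℚ n          ≡⟨ cong (_* ℕ→ℚ n) (ℕ→ℚ-suc m) ⟨
  ℕ→ℚ (suc m) * ℕ→ℚ n           ∎
  where
  open ≡-Reasoning
  distrib : ∀ a b → b + a * b ≡ (1ℚ + a) * b
  distrib = solve-∀ ℚ-ring

ℕ→ℚ-nonNeg : ∀ m → 0ℚ ≤ ℕ→ℚ m
ℕ→ℚ-nonNeg m rewrite ℕ→ℚ≡mkℚ m = nonNegative⁻¹ _

ℕ→ℚ-suc-positive : ∀ m → Positive (ℕ→ℚ (suc m))
ℕ→ℚ-suc-positive m rewrite ℕ→ℚ≡mkℚ (suc m) = _

1/ℕ→ℚ-suc : ℕ → ℚ
1/ℕ→ℚ-suc n = (1/ ℕ→ℚ (suc n)) {{pos⇒nonZero (ℕ→ℚ (suc n)) {{ℕ→ℚ-suc-positive n}}}}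

ℕ→ℚ-suc-*-inverse : ∀ n → ℕ→ℚ (suc n) * 1/ℕ→ℚ-suc n ≡ 1ℚ
ℕ→ℚ-suc-*-inverse n = *-inverseʳ (ℕ→ℚ (suc n)) {{pos⇒nonZero (ℕ→ℚ (suc n)) {{ℕ→ℚ-suc-positive n}}}}

1/ℕ→ℚ-suc-nonNeg : ∀ n → 0ℚ ≤ 1/ℕ→ℚ-suc n
1/ℕ→ℚ-suc-nonNeg n =
  <⇒≤ (positive⁻¹ (1/ℕ→ℚ-suc n) {{1/pos⇒pos (ℕ→ℚ (suc n)) {{ℕ→ℚ-suc-positive n}}}})

ℕ→ℚ-suc-*-cancel : ∀ n {b} → ℕ→ℚ (suc n) * b ≡ 0ℚ → b ≡ 0ℚ
ℕ→ℚ-suc-*-cancel n {b} Nb≡0 = begin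
  b                        ≡⟨ *-identityˡ b ⟨
  1ℚ * b                   ≡⟨ cong (_* b) (trans (*-comm N⁻¹ N) (ℕ→ℚ-suc-*-inverse n)) ⟨
  (N⁻¹ * N) * b            ≡⟨ *-assoc N⁻¹ N b ⟩
  N⁻¹ * (N * b)            ≡⟨ cong (N⁻¹ *_) Nb≡0 ⟩
  N⁻¹ * 0ℚ                 ≡⟨ *-zeroʳ N⁻¹ ⟩
  0ℚ                       ∎
  where
  open ≡-Reasoning
  N = ℕ→ℚ (suc n)
  N⁻¹ = 1/ℕ→ℚ-suc n

ℕ→ℚ-suc-*-nonNeg⁻¹ : ∀ n {b} → 0ℚ ≤ ℕ→ℚ (suc n) * b → 0ℚ ≤ b
ℕ→ℚ-suc-*-nonNeg⁻¹ n {b} 0≤Nb = *-cancelˡ-≤-pos (ℕ→ℚ (suc n)) {{ℕ→ℚ-suc-positive n}}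
  (subst (_≤ ℕ→ℚ (suc n) * b) (sym (*-zeroʳ (ℕ→ℚ (suc n)))) 0≤Nb)

p≤q⇒0≤q-p : ∀ {p q} → p ≤ q → 0ℚ ≤ q - p
p≤q⇒0≤q-p {p} {q} p≤q = subst (_≤ q - p) (+-inverseʳ p) (+-monoˡ-≤ (- p) p≤q)

0≤q-p⇒p≤q : ∀ {p q} → 0ℚ ≤ q - p → p ≤ q
0≤q-p⇒p≤q {p} {q} 0≤q-p = subst₂ _≤_ (+-identityˡ p) (cancel p q) (+-monoˡ-≤ p 0≤q-p)
  where
  cancel : ∀ p q → q - p + p ≡ q
  cancel = solve-∀ ℚ-ring

nonNeg-* : ∀ {p q} → 0ℚ ≤ p → 0ℚ ≤ q → 0ℚ ≤ p * q
nonNeg-* {p} {q} 0≤p 0≤q = subst (_≤ p * q) (*-zeroˡ q) (*-monoʳ-≤-nonNeg q {{nonNegative 0≤q}} 0≤p)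

p≤∣p∣ : ∀ p → p ≤ ∣ p ∣
p≤∣p∣ p with ∣p∣≡p∨∣p∣≡-p p
... | inj₁ ∣p∣≡p  = ≤-reflexive (sym ∣p∣≡p)
... | inj₂ ∣p∣≡-p = 0≤q-p⇒p≤q (subst (λ z → 0ℚ ≤ z - p) (sym ∣p∣≡-p) (+-mono-≤ 0≤-p 0≤-p))
  where
  0≤-p : 0ℚ ≤ - p
  0≤-p = subst (0ℚ ≤_) ∣p∣≡-p (0≤∣p∣ p)

-p≤∣p∣ : ∀ p → - p ≤ ∣ p ∣
-p≤∣p∣ p = subst (- p ≤_) (∣-p∣≡∣p∣ p) (p≤∣p∣ (- p))

ΣF-cong : ∀ {n} {f g : Fin n → ℚ} → f ≗ g → ΣF f ≡ ΣF g
ΣF-cong {zero} f≗g = refl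
ΣF-cong {suc n} f≗g = cong₂ _+_ (f≗g zero) (ΣF-cong (λ i → f≗g (suc i)))

ΣF-0 : ∀ {n} → ΣF {n} (λ _ → 0ℚ) ≡ 0ℚ
ΣF-0 {zero} = refl
ΣF-0 {suc n} rewrite ΣF-0 {n} = refl

ΣF-+ : ∀ {n} (f g : Fin n → ℚ) → ΣF (λ i → f i + g i) ≡ ΣF f + ΣF g
ΣF-+ {zero} f g = refl
ΣF-+ {suc n} f g rewrite ΣF-+ (λ i → f (suc i)) (λ i → g (suc i)) =
  interchange (f zero) (g zero) (ΣF (λ i → f (suc i))) (ΣF (λ i → g (suc i)))
  where
  interchange : ∀ a b c d → a + b + (c + d) ≡ a + c + (b + d)
  interchange = solve-∀ ℚ-ring

ΣF-*ˡ : ∀ {n} c (f : Fin n → ℚ) → ΣF (λ i → c * f i) ≡ c * ΣF f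
ΣF-*ˡ {zero} c f = sym (*-zeroʳ c)
ΣF-*ˡ {suc n} c f rewrite ΣF-*ˡ c (λ i → f (suc i)) = sym (*-distribˡ-+ c (f zero) _)

ΣF-*ʳ : ∀ {n} c (f : Fin n → ℚ) → ΣF (λ i → f i * c) ≡ ΣF f * c
ΣF-*ʳ c f = trans (ΣF-cong (λ i → *-comm (f i) c)) (trans (ΣF-*ˡ c f) (*-comm c (ΣF f)))

ΣF-neg : ∀ {n} (f : Fin n → ℚ) → ΣF (λ i → - f i) ≡ - ΣF f
ΣF-neg {zero} f = refl
ΣF-neg {suc n} f rewrite ΣF-neg (λ i → f (suc i)) = sym (neg-distrib-+ (f zero) _)

ΣF-- : ∀ {n} (f g : Fin n → ℚ) → ΣF (λ i → f i - g i) ≡ ΣF f - ΣF g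
ΣF-- f g = trans (ΣF-+ f (λ i → - g i)) (cong (ΣF f +_) (ΣF-neg g))

ΣF-const : ∀ {n} c → ΣF {n} (λ _ → c) ≡ ℕ→ℚ n * c
ΣF-const {zero} c = sym (*-zeroˡ c)
ΣF-const {suc n} c = begin
  c + ΣF {n} (λ _ → c)   ≡⟨ cong (c +_) (ΣF-const {n} c) ⟩
  c + ℕ→ℚ n * c          ≡⟨ distrib (ℕ→ℚ n) c ⟩
  (1ℚ + ℕ→ℚ n) * c       ≡⟨ cong (_* c) (ℕ→ℚ-suc n) ⟨
  ℕ→ℚ (suc n) * c        ∎
  where
  open ≡-Reasoning
  distrib : ∀ a b → b + a * b ≡ (1ℚ + a) * b
  distrib = solve-∀ ℚ-ring

ΣF-swap : ∀ {m n} (g : Fin m → Fin n → ℚ) →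
  ΣF (λ i → ΣF (λ j → g i j)) ≡ ΣF (λ j → ΣF (λ i → g i j))
ΣF-swap {zero} {n} g = sym (ΣF-0 {n})
ΣF-swap {suc m} g rewrite ΣF-swap (λ i j → g (suc i) j) =
  sym (ΣF-+ (λ j → g zero j) (λ j → ΣF (λ i → g (suc i) j)))

ΣF-single : ∀ {n} (f : Fin n → ℚ) k → (∀ i → i ≢ k → f i ≡ 0ℚ) → ΣF f ≡ f k
ΣF-single {suc n} f zero f≡0 = begin
  f zero + ΣF (λ i → f (suc i))  ≡⟨ cong (f zero +_) (ΣF-cong (λ i → f≡0 (suc i) (λ ()))) ⟩
  f zero + ΣF {n} (λ _ → 0ℚ)     ≡⟨ cong (f zero +_) (ΣF-0 {n}) ⟩
  f zero + 0ℚ                    ≡⟨ +-identityʳ (f zero) ⟩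
  f zero                         ∎
  where open ≡-Reasoning
ΣF-single {suc n} f (suc k) f≡0 = trans (cong₂ _+_ (f≡0 zero λ ()) rest) (+-identityˡ (f (suc k)))
  where
  rest : ΣF (λ i → f (suc i)) ≡ f (suc k)
  rest = ΣF-single (λ i → f (suc i)) k (λ i i≢k → f≡0 (suc i) (λ eq → i≢k (Finₚ.suc-injective eq)))

ΣF-mono-≤ : ∀ {n} {f g : Fin n → ℚ} → (∀ i → f i ≤ g i) → ΣF f ≤ ΣF g
ΣF-mono-≤ {zero} f≤g = ≤-refl
ΣF-mono-≤ {suc n} f≤g = +-mono-≤ (f≤g zero) (ΣF-mono-≤ (λ i → f≤g (suc i)))

∣ΣF∣≤ΣF∣∣ : ∀ {n} (f : Fin n → ℚ) → ∣ ΣF f ∣ ≤ ΣF (λ i → ∣ f i ∣)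
∣ΣF∣≤ΣF∣∣ {zero} f = ≤-refl
∣ΣF∣≤ΣF∣∣ {suc n} f =
  ≤-trans (∣p+q∣≤∣p∣+∣q∣ (f zero) _) (+-monoʳ-≤ ∣ f zero ∣ (∣ΣF∣≤ΣF∣∣ (λ i → f (suc i))))

ΣF-init-last : ∀ {n} (f : Fin (suc n) → ℚ) → ΣF f ≡ ΣF (λ i → f (inject₁ i)) + f (fromℕ n)
ΣF-init-last {zero} f = trans (+-identityʳ (f zero)) (sym (+-identityˡ (f zero)))
ΣF-init-last {suc n} f rewrite ΣF-init-last (λ i → f (suc i)) = sym (+-assoc (f zero) _ _)

lincomb : ∀ {m n} → (Fin m → ℚ) → (Fin m → Pt n) → Pt n
lincomb c p t = ΣF (λ i → c i * p i t)

dot : ∀ {n} → Pt n → Pt n → ℚ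
dot β x = ΣF (λ t → β t * x t)

dot-lincomb : ∀ {m n} (β : Pt n) (c : Fin m → ℚ) (p : Fin m → Pt n) →
  dot β (lincomb c p) ≡ ΣF (λ i → c i * dot β (p i))
dot-lincomb β c p = begin
  ΣF (λ t → β t * ΣF (λ i → c i * p i t))  ≡⟨ ΣF-cong (λ t → ΣF-*ˡ (β t) (λ i → c i * p i t)) ⟨
  ΣF (λ t → ΣF (λ i → β t * (c i * p i t))) ≡⟨ ΣF-swap (λ t i → β t * (c i * p i t)) ⟩
  ΣF (λ i → ΣF (λ t → β t * (c i * p i t))) ≡⟨ ΣF-cong (λ i → ΣF-cong (λ t → swap (β t) (c i) (p i t))) ⟩
  ΣF (λ i → ΣF (λ t → c i * (β t * p i t))) ≡⟨ ΣF-cong (λ i → ΣF-*ˡ (c i) (λ t → β t * p i t)) ⟩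
  ΣF (λ i → c i * dot β (p i))              ∎
  where
  open ≡-Reasoning
  swap : ∀ a b c → a * (b * c) ≡ b * (a * c)
  swap = solve-∀ ℚ-ring

dot-cong : ∀ {n} (β : Pt n) {x y : Pt n} → x ≗ y → dot β x ≡ dot β y
dot-cong β x≗y = ΣF-cong (λ t → cong (β t *_) (x≗y t))

ΣF≡dot-1 : ∀ {n} (x : Pt n) → ΣF x ≡ dot (λ _ → 1ℚ) x
ΣF≡dot-1 x = ΣF-cong (λ t → sym (*-identityˡ (x t)))

ΣF-weighted-const : ∀ {m} (w : Fin m → ℚ) c → ΣF w ≡ 1ℚ → ΣF (λ i → w i * c) ≡ c
ΣF-weighted-const w c Σw≡1 = trans (ΣF-*ʳ c w) (trans (cong (_* c) Σw≡1) (*-identityˡ c))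

snoc : ∀ {n} {A : Set} → (Fin n → A) → A → Fin (suc n) → A
snoc {zero} f a _ = a
snoc {suc n} f a zero = f zero
snoc {suc n} f a (suc i) = snoc (λ j → f (suc j)) a i

snoc-inject₁ : ∀ {n} {A : Set} (f : Fin n → A) a i → snoc f a (inject₁ i) ≡ f i
snoc-inject₁ {suc n} f a zero = refl
snoc-inject₁ {suc n} f a (suc i) = snoc-inject₁ (λ j → f (suc j)) a i

snoc-fromℕ : ∀ {n} {A : Set} (f : Fin n → A) a → snoc f a (fromℕ n) ≡ a
snoc-fromℕ {zero} f a = refl
snoc-fromℕ {suc n} f a = snoc-fromℕ (λ j → f (suc j)) a

snoc-cong : ∀ {n} {A : Set} {f g : Fin n → A} {a b} → f ≗ g → a ≡ b → snoc f a ≗ snoc g b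
snoc-cong {zero} f≗g a≡b t = a≡b
snoc-cong {suc n} f≗g a≡b zero = f≗g zero
snoc-cong {suc n} f≗g a≡b (suc t) = snoc-cong (λ j → f≗g (suc j)) a≡b t

snoc-map : ∀ {n} {A B : Set} (g : A → B) (f : Fin n → A) a →
  (λ i → g (snoc f a i)) ≗ snoc (λ j → g (f j)) (g a)
snoc-map {zero} g f a i = refl
snoc-map {suc n} g f a zero = refl
snoc-map {suc n} g f a (suc i) = snoc-map g (λ j → f (suc j)) a i

snoc-All : ∀ {n} {A : Set} (Q : A → Set) {f : Fin n → A} {a} →
  (∀ i → Q (f i)) → Q a → ∀ i → Q (snoc f a i)
snoc-All Q {f} {a} Qf Qa i with view i
... | ‵fromℕ = subst Q (sym (snoc-fromℕ f a)) Qa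
... | ‵inj₁ {i = j} _ = subst Q (sym (snoc-inject₁ f a j)) (Qf j)

snoc-init-last : ∀ {n} {A : Set} (x : Fin (suc n) → A) → x ≗ snoc (λ s → x (inject₁ s)) (x (fromℕ n))
snoc-init-last x t with view t
... | ‵fromℕ = sym (snoc-fromℕ (λ s → x (inject₁ s)) _)
... | ‵inj₁ {i = s} _ = sym (snoc-inject₁ (λ s → x (inject₁ s)) _ s)

append : ∀ {m m′} {A : Set} → (Fin m → A) → (Fin m′ → A) → Fin (m ℕ.+ m′) → A
append {zero} f g = g
append {suc m} f g zero = f zero
append {suc m} f g (suc i) = append (λ j → f (suc j)) g i

ΣF-append : ∀ {m m′} (f : Fin m → ℚ) (g : Fin m′ → ℚ) → ΣF (append f g) ≡ ΣF f + ΣF g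
ΣF-append {zero} f g = sym (+-identityˡ (ΣF g))
ΣF-append {suc m} f g rewrite ΣF-append (λ j → f (suc j)) g = sym (+-assoc (f zero) _ _)

append-zipWith : ∀ {m m′} {A B C : Set} (h : A → B → C) (f₁ : Fin m → A) (g₁ : Fin m′ → A) f₂ g₂ →
  (λ i → h (append f₁ g₁ i) (append f₂ g₂ i)) ≗ append (λ j → h (f₁ j) (f₂ j)) (λ j → h (g₁ j) (g₂ j))
append-zipWith {zero} h f₁ g₁ f₂ g₂ i = refl
append-zipWith {suc m} h f₁ g₁ f₂ g₂ zero = refl
append-zipWith {suc m} h f₁ g₁ f₂ g₂ (suc i) =
  append-zipWith h (λ j → f₁ (suc j)) g₁ (λ j → f₂ (suc j)) g₂ i

append-All : ∀ {m m′} {A : Set} (Q : A → Set) {f : Fin m → A} {g : Fin m′ → A} →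
  (∀ i → Q (f i)) → (∀ i → Q (g i)) → ∀ i → Q (append f g i)
append-All {zero} Q Qf Qg i = Qg i
append-All {suc m} Q Qf Qg zero = Qf zero
append-All {suc m} Q Qf Qg (suc i) = append-All Q (λ j → Qf (suc j)) Qg i

mix : ∀ {n} → ℚ → Pt n → Pt n → Pt n
mix l x y t = l * x t + (1ℚ - l) * y t

mix-snoc : ∀ {n} l (f : Pt n) a (g : Pt n) b → mix l (snoc f a) (snoc g b) ≗ snoc (mix l f g) (l * a + (1ℚ - l) * b)
mix-snoc l f a g b t with view t
... | ‵fromℕ = trans (cong₂ (λ p q → l * p + (1ℚ - l) * q) (snoc-fromℕ f a) (snoc-fromℕ g b)) (sym (snoc-fromℕ (mix l f g) _))
... | ‵inj₁ {i = s} _ = trans (cong₂ (λ p q → l * p + (1ℚ - l) * q) (snoc-inject₁ f a s) (snoc-inject₁ g b s))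
                               (sym (snoc-inject₁ (mix l f g) _ s))

module _ {n : ℕ} {S : Pt n → Set} where

  Conv-resp : ∀ {x y} → x ≗ y → Conv S x → Conv S y
  Conv-resp x≗y (m , w , p , Sp , 0≤w , Σw≡1 , x≗) = m , w , p , Sp , 0≤w , Σw≡1 , λ t → trans (x≗ t) (x≗y t)

  Conv-dot-≡ : ∀ β K → (∀ {y} → S y → dot β y ≡ K) → ∀ {x} → Conv S x → dot β x ≡ K
  Conv-dot-≡ β K on-S {x} (m , w , p , Sp , _ , Σw≡1 , x≗) = begin
    dot β x                          ≡⟨ dot-cong β x≗ ⟨
    dot β (lincomb w p)              ≡⟨ dot-lincomb β w p ⟩
    ΣF (λ i → w i * dot β (p i))     ≡⟨ ΣF-cong (λ i → cong (w i *_) (on-S (Sp i))) ⟩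
    ΣF (λ i → w i * K)               ≡⟨ ΣF-weighted-const w K Σw≡1 ⟩
    K                                ∎
    where open ≡-Reasoning

  Conv-∣dot∣≤ : ∀ β K → (∀ {y} → S y → ∣ dot β y ∣ ≤ K) → ∀ {x} → Conv S x → ∣ dot β x ∣ ≤ K
  Conv-∣dot∣≤ β K on-S {x} (m , w , p , Sp , 0≤w , Σw≡1 , x≗) = begin
    ∣ dot β x ∣                         ≡⟨ cong ∣_∣ (trans (sym (dot-cong β x≗)) (dot-lincomb β w p)) ⟩
    ∣ ΣF (λ i → w i * dot β (p i)) ∣    ≤⟨ ∣ΣF∣≤ΣF∣∣ (λ i → w i * dot β (p i)) ⟩
    ΣF (λ i → ∣ w i * dot β (p i) ∣)    ≤⟨ ΣF-mono-≤ term≤ ⟩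
    ΣF (λ i → w i * K)                  ≡⟨ ΣF-weighted-const w K Σw≡1 ⟩
    K                                   ∎
    where
    open ≤-Reasoning
    term≤ : ∀ i → ∣ w i * dot β (p i) ∣ ≤ w i * K
    term≤ i = subst (_≤ w i * K)
      (sym (trans (∣p*q∣≡∣p∣*∣q∣ (w i) _) (cong (_* ∣ dot β (p i) ∣) (0≤p⇒∣p∣≡p (0≤w i)))))
      (*-monoˡ-≤-nonNeg (w i) {{nonNegative (0≤w i)}} (on-S (Sp i)))

  Conv-mix : ∀ {l x y} → 0ℚ ≤ l → l ≤ 1ℚ → Conv S x → Conv S y → Conv S (mix l x y)
  Conv-mix {l} {x} {y} 0≤l l≤1 (m₁ , w₁ , p₁ , Sp₁ , 0≤w₁ , Σw₁≡1 , x≗)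
                                (m₂ , w₂ , p₂ , Sp₂ , 0≤w₂ , Σw₂≡1 , y≗) =
    m₁ ℕ.+ m₂ , w , append p₁ p₂ , append-All S Sp₁ Sp₂ ,
    append-All (0ℚ ≤_) (λ i → nonNeg-* 0≤l (0≤w₁ i)) (λ i → nonNeg-* 0≤1-l (0≤w₂ i)) , Σw≡1 , mix≗
    where
    open ≡-Reasoning
    w = append (λ i → l * w₁ i) (λ i → (1ℚ - l) * w₂ i)
    0≤1-l : 0ℚ ≤ 1ℚ - l
    0≤1-l = p≤q⇒0≤q-p l≤1
    Σw≡1 : ΣF w ≡ 1ℚ
    Σw≡1 = begin
      ΣF w                                             ≡⟨ ΣF-append (λ i → l * w₁ i) (λ i → (1ℚ - l) * w₂ i) ⟩
      ΣF (λ i → l * w₁ i) + ΣF (λ i → (1ℚ - l) * w₂ i) ≡⟨ cong₂ _+_ (ΣF-*ˡ l w₁) (ΣF-*ˡ (1ℚ - l) w₂) ⟩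
      l * ΣF w₁ + (1ℚ - l) * ΣF w₂                     ≡⟨ cong₂ (λ a b → l * a + (1ℚ - l) * b) Σw₁≡1 Σw₂≡1 ⟩
      l * 1ℚ + (1ℚ - l) * 1ℚ                           ≡⟨ partition l ⟩
      1ℚ                                               ∎
      where
      partition : ∀ l → l * 1ℚ + (1ℚ - l) * 1ℚ ≡ 1ℚ
      partition = solve-∀ ℚ-ring
    scaled : ∀ {k} c (v : Fin k → ℚ) (q : Fin k → Pt n) t → ΣF (λ i → (c * v i) * q i t) ≡ c * lincomb v q t
    scaled c v q t = trans (ΣF-cong (λ i → *-assoc c (v i) (q i t))) (ΣF-*ˡ c (λ i → v i * q i t))
    mix≗ : lincomb w (append p₁ p₂) ≗ mix l x y
    mix≗ t = begin
      lincomb w (append p₁ p₂) t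
        ≡⟨ ΣF-cong (append-zipWith (λ c q → c * q t) (λ i → l * w₁ i) (λ i → (1ℚ - l) * w₂ i) p₁ p₂) ⟩
      ΣF (append (λ i → (l * w₁ i) * p₁ i t) (λ i → ((1ℚ - l) * w₂ i) * p₂ i t))
        ≡⟨ ΣF-append (λ i → (l * w₁ i) * p₁ i t) (λ i → ((1ℚ - l) * w₂ i) * p₂ i t) ⟩
      ΣF (λ i → (l * w₁ i) * p₁ i t) + ΣF (λ i → ((1ℚ - l) * w₂ i) * p₂ i t)
        ≡⟨ cong₂ _+_ (scaled l w₁ p₁ t) (scaled (1ℚ - l) w₂ p₂ t) ⟩
      l * lincomb w₁ p₁ t + (1ℚ - l) * lincomb w₂ p₂ t
        ≡⟨ cong₂ (λ a b → l * a + (1ℚ - l) * b) (x≗ t) (y≗ t) ⟩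
      mix l x y t ∎

Affine : ∀ {n n′} → (Pt n → Pt n′) → Set
Affine {n} f = ∀ {m} (w : Fin m → ℚ) (p : Fin m → Pt n) {x} →
  ΣF w ≡ 1ℚ → lincomb w p ≗ x → lincomb w (λ i → f (p i)) ≗ f x

Conv-map : ∀ {n n′} {S : Pt n → Set} {T : Pt n′ → Set} (f : Pt n → Pt n′) → Affine f →
  (∀ {y} → S y → ∃[ z ] T z × z ≗ f y) → ∀ {x} → Conv S x → Conv T (f x)
Conv-map f f-affine S⇒T (m , w , p , Sp , 0≤w , Σw≡1 , x≗) =
  m , w , (λ i → proj₁ (S⇒T (Sp i))) , (λ i → proj₁ (proj₂ (S⇒T (Sp i)))) , 0≤w , Σw≡1 ,
  λ t → trans (ΣF-cong (λ i → cong (w i *_) (proj₂ (proj₂ (S⇒T (Sp i))) t))) (f-affine w p Σw≡1 x≗ t)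

<ᵇ-true : ∀ {m n} → m ℕ.< n → (m <ᵇ n) ≡ true
<ᵇ-true {zero} {suc n} _ = refl
<ᵇ-true {suc m} {suc n} (ℕ.s≤s m<n) = <ᵇ-true {m} {n} m<n

<ᵇ-false : ∀ {m n} → n ℕ.≤ m → (m <ᵇ n) ≡ false
<ᵇ-false {m} {zero} _ = refl
<ᵇ-false {suc m} {suc n} (ℕ.s≤s n≤m) = <ᵇ-false {m} {n} n≤m

≡ᵇ-true : ∀ {m n} → m ≡ n → (m ≡ᵇ n) ≡ true
≡ᵇ-true {zero} refl = refl
≡ᵇ-true {suc m} refl = ≡ᵇ-true {m} refl

≡ᵇ-false : ∀ {m n} → m ≢ n → (m ≡ᵇ n) ≡ false
≡ᵇ-false {zero} {zero} m≢n = ⊥-elim (m≢n refl)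
≡ᵇ-false {zero} {suc n} _ = refl
≡ᵇ-false {suc m} {zero} _ = refl
≡ᵇ-false {suc m} {suc n} m≢n = ≡ᵇ-false {m} {n} (λ eq → m≢n (cong suc eq))

if-cong : ∀ {A : Set} b {x y z : A} → x ≡ y → (if b then x else z) ≡ (if b then y else z)
if-cong true x≡y = x≡y
if-cong false _ = refl

prefix : ∀ {n} → (Fin n → ℚ) → ℕ → ℚ
prefix f j = ΣF (λ i → if toℕ i <ᵇ j then f i else 0ℚ)

prefix-0 : ∀ {n} (f : Fin n → ℚ) → prefix f 0 ≡ 0ℚ
prefix-0 {n} f = ΣF-0 {n}

prefix-full : ∀ {n} (f : Fin n → ℚ) j → n ℕ.≤ j → prefix f j ≡ ΣF f
prefix-full {zero} f j _ = refl
prefix-full {suc n} f (suc j) (ℕ.s≤s n≤j) = cong (f zero +_) (prefix-full (λ i → f (suc i)) j n≤j)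

prefix-suc : ∀ {n} (f : Fin n → ℚ) i → prefix f (suc (toℕ i)) ≡ prefix f (toℕ i) + f i
prefix-suc {suc n} f zero = begin
  f zero + prefix (λ i → f (suc i)) 0   ≡⟨ cong (f zero +_) (prefix-0 (λ i → f (suc i))) ⟩
  f zero + 0ℚ                           ≡⟨ +-comm (f zero) 0ℚ ⟩
  0ℚ + f zero                           ≡⟨ cong (_+ f zero) (prefix-0 f) ⟨
  prefix f 0 + f zero                   ∎
  where open ≡-Reasoning
prefix-suc {suc n} f (suc i) rewrite prefix-suc (λ j → f (suc j)) i = sym (+-assoc (f zero) _ _)

prefix-sub : ∀ {n} (f : Fin n → ℚ) c j → j ℕ.≤ n → prefix (λ i → f i - c) j ≡ prefix f j - ℕ→ℚ j * c
prefix-sub {n} f c zero _ = begin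
  prefix (λ i → f i - c) 0   ≡⟨ prefix-0 (λ i → f i - c) ⟩
  0ℚ                         ≡⟨ cong₂ (λ a b → a - b) (prefix-0 f) (*-zeroˡ c) ⟨
  prefix f 0 - 0ℚ * c        ∎
  where open ≡-Reasoning
prefix-sub {suc n} f c (suc j) (ℕ.s≤s j≤n) = begin
  (f zero - c) + prefix (λ i → f (suc i) - c) j
    ≡⟨ cong ((f zero - c) +_) (prefix-sub (λ i → f (suc i)) c j j≤n) ⟩
  (f zero - c) + (prefix (λ i → f (suc i)) j - ℕ→ℚ j * c)
    ≡⟨ regroup (f zero) (prefix (λ i → f (suc i)) j) c (ℕ→ℚ j) ⟩
  f zero + prefix (λ i → f (suc i)) j - (1ℚ + ℕ→ℚ j) * c
    ≡⟨ cong (λ z → f zero + prefix (λ i → f (suc i)) j - z * c) (ℕ→ℚ-suc j) ⟨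
  f zero + prefix (λ i → f (suc i)) j - ℕ→ℚ (suc j) * c ∎
  where
  open ≡-Reasoning
  regroup : ∀ a b c d → a - c + (b - d * c) ≡ a + b - (1ℚ + d) * c
  regroup = solve-∀ ℚ-ring

L≡prefix : ∀ {n} (k : Fin n) (x : Pt n) → L k x ≡ prefix x (toℕ k) - ℕ→ℚ (toℕ k) * x k
L≡prefix k x = prefix-sub x (x k) (toℕ k) (ℕₚ.<⇒≤ (Finₚ.toℕ<n k))

L-cong : ∀ {n} (k : Fin n) {x y : Pt n} → x ≗ y → L k x ≡ L k y
L-cong k x≗y = ΣF-cong (λ i → if-cong (toℕ i <ᵇ toℕ k) (cong₂ _-_ (x≗y i) (x≗y k)))

L-shift : ∀ {n} (k : Fin n) (x : Pt n) c → L k (λ t → x t + c) ≡ L k x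
L-shift k x c = ΣF-cong (λ i → if-cong (toℕ i <ᵇ toℕ k) (cancel (x i) (x k) c))
  where
  cancel : ∀ a b c → (a + c) - (b + c) ≡ a - b
  cancel = solve-∀ ℚ-ring

L-snoc-inject₁ : ∀ {n} (k : Fin n) (f : Pt n) a → L (inject₁ k) (snoc f a) ≡ L k f
L-snoc-inject₁ {n} k f a =
  trans (ΣF-init-last summand) (trans (cong₂ _+_ (ΣF-cong term) last-term) (+-identityʳ (L k f)))
  where
  summand : Fin (suc n) → ℚ
  summand i = if toℕ i <ᵇ toℕ (inject₁ k) then snoc f a i - snoc f a (inject₁ k) else 0ℚ
  term : ∀ i → summand (inject₁ i) ≡ (if toℕ i <ᵇ toℕ k then f i - f k else 0ℚ)
  term i rewrite Finₚ.toℕ-inject₁ i | Finₚ.toℕ-inject₁ k | snoc-inject₁ f a i | snoc-inject₁ f a k = refl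
  last-term : summand (fromℕ n) ≡ 0ℚ
  last-term rewrite Finₚ.toℕ-fromℕ n | Finₚ.toℕ-inject₁ k | <ᵇ-false {n} {toℕ k} (ℕₚ.<⇒≤ (Finₚ.toℕ<n k)) = refl

L-snoc-fromℕ : ∀ {n} (f : Pt n) a → L (fromℕ n) (snoc f a) ≡ ΣF f - ℕ→ℚ n * a
L-snoc-fromℕ {n} f a = begin
  L (fromℕ n) (snoc f a)      ≡⟨ ΣF-init-last summand ⟩
  ΣF (λ i → summand (inject₁ i)) + summand (fromℕ n)
                              ≡⟨ cong₂ _+_ (ΣF-cong term) last-term ⟩
  ΣF (λ i → f i - a) + 0ℚ     ≡⟨ +-identityʳ _ ⟩
  ΣF (λ i → f i - a)          ≡⟨ ΣF-- f (λ _ → a) ⟩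
  ΣF f - ΣF {n} (λ _ → a)     ≡⟨ cong (λ z → ΣF f - z) (ΣF-const {n} a) ⟩
  ΣF f - ℕ→ℚ n * a            ∎
  where
  open ≡-Reasoning
  summand : Fin (suc n) → ℚ
  summand i = if toℕ i <ᵇ toℕ (fromℕ n) then snoc f a i - snoc f a (fromℕ n) else 0ℚ
  term : ∀ i → summand (inject₁ i) ≡ f i - a
  term i rewrite Finₚ.toℕ-inject₁ i | Finₚ.toℕ-fromℕ n | snoc-inject₁ f a i | snoc-fromℕ f a
    | <ᵇ-true (Finₚ.toℕ<n i) = refl
  last-term : summand (fromℕ n) ≡ 0ℚ
  last-term rewrite Finₚ.toℕ-fromℕ n | <ᵇ-false {n} {n} ℕₚ.≤-refl = refl

indicator : Bool → ℚ
indicator b = if b then 1ℚ else 0ℚ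

α : ∀ {n} → Fin n → Pt n
α k t = indicator (toℕ t <ᵇ toℕ k) - ℕ→ℚ (toℕ k) * indicator (toℕ t ≡ᵇ toℕ k)

if-then-0 : ∀ b x → (if b then x else 0ℚ) ≡ indicator b * x
if-then-0 true x = sym (*-identityˡ x)
if-then-0 false x = sym (*-zeroˡ x)

indicator-≡ᵇ-single : ∀ {n} (k : Fin n) t → t ≢ k → indicator (toℕ t ≡ᵇ toℕ k) ≡ 0ℚ
indicator-≡ᵇ-single k t t≢k rewrite ≡ᵇ-false {toℕ t} {toℕ k} (λ eq → t≢k (Finₚ.toℕ-injective eq)) = refl

indicator-≡ᵇ-refl : ∀ {n} (k : Fin n) → indicator (toℕ k ≡ᵇ toℕ k) ≡ 1ℚ
indicator-≡ᵇ-refl k rewrite ≡ᵇ-true {toℕ k} refl = refl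

dot-indicator-≡ᵇ : ∀ {n} (k : Fin n) (x : Pt n) → dot (λ t → indicator (toℕ t ≡ᵇ toℕ k)) x ≡ x k
dot-indicator-≡ᵇ k x = begin
  dot (λ t → indicator (toℕ t ≡ᵇ toℕ k)) x  ≡⟨ ΣF-single _ k off-k ⟩
  indicator (toℕ k ≡ᵇ toℕ k) * x k          ≡⟨ cong (_* x k) (indicator-≡ᵇ-refl k) ⟩
  1ℚ * x k                                  ≡⟨ *-identityˡ (x k) ⟩
  x k                                       ∎
  where
  open ≡-Reasoning
  off-k : ∀ t → t ≢ k → indicator (toℕ t ≡ᵇ toℕ k) * x t ≡ 0ℚ
  off-k t t≢k = trans (cong (_* x t) (indicator-≡ᵇ-single k t t≢k)) (*-zeroˡ (x t))

L≡dot-α : ∀ {n} (k : Fin n) (x : Pt n) → L k x ≡ dot (α k) x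
L≡dot-α k x = begin
  L k x                                                                   ≡⟨ L≡prefix k x ⟩
  prefix x (toℕ k) - K * x k
    ≡⟨ cong₂ (λ a b → a - K * b) (ΣF-cong (λ t → if-then-0 (toℕ t <ᵇ toℕ k) (x t))) (sym (dot-indicator-≡ᵇ k x)) ⟩
  dot (λ t → indicator (toℕ t <ᵇ toℕ k)) x - K * dot (λ t → indicator (toℕ t ≡ᵇ toℕ k)) x
    ≡⟨ cong (λ z → dot (λ t → indicator (toℕ t <ᵇ toℕ k)) x - z) (ΣF-*ˡ K (λ t → indicator (toℕ t ≡ᵇ toℕ k) * x t)) ⟨
  dot (λ t → indicator (toℕ t <ᵇ toℕ k)) x - ΣF (λ t → K * (indicator (toℕ t ≡ᵇ toℕ k) * x t))
    ≡⟨ ΣF-- (λ t → indicator (toℕ t <ᵇ toℕ k) * x t) (λ t → K * (indicator (toℕ t ≡ᵇ toℕ k) * x t)) ⟨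
  ΣF (λ t → indicator (toℕ t <ᵇ toℕ k) * x t - K * (indicator (toℕ t ≡ᵇ toℕ k) * x t))
    ≡⟨ ΣF-cong (λ t → factor (indicator (toℕ t <ᵇ toℕ k)) K (indicator (toℕ t ≡ᵇ toℕ k)) (x t)) ⟩
  dot (α k) x                                                             ∎
  where
  open ≡-Reasoning
  K = ℕ→ℚ (toℕ k)
  factor : ∀ a b c d → a * d - b * (c * d) ≡ (a - b * c) * d
  factor = solve-∀ ℚ-ring

-- Permutations avoiding 132 and 312

Avoids : ∀ {n} → (Fin n → ℕ) → Set
Avoids {n} a = ∀ (i j k : Fin n) → toℕ i ℕ.< toℕ j → toℕ j ℕ.< toℕ k →
  ¬ (a i ℕ.< a k × a k ℕ.< a j) × ¬ (a j ℕ.< a k × a k ℕ.< a i)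

VertexSeq : ∀ {n} → (Fin n → ℕ) → Set
VertexSeq a = Injective _≡_ _≡_ a × Avoids a

val : ∀ {n} → (Fin n → Fin n) → Fin n → ℕ
val σ i = toℕ (σ i)

Vert⇒VertexSeq : ∀ {n} {x} → (v : Vert n x) → VertexSeq (val (proj₁ (proj₁ v)))
Vert⇒VertexSeq ((σ , σ-inj) , no132 , no312 , _) =
  (λ eq → σ-inj (Finₚ.toℕ-injective eq)) ,
  λ i j k i<j j<k → (λ (ik , kj) → no132 (i , j , k , i<j , j<k , ik , kj)) ,
                    (λ (jk , ki) → no312 (i , j , k , i<j , j<k , jk , ki))

VertexSeq⇒Vert : ∀ {n} (σ : Fin n → Fin n) → VertexSeq (val σ) → Vert n (permPt σ)
VertexSeq⇒Vert σ (inj , av) =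
  (σ , λ eq → inj (cong toℕ eq)) ,
  (λ (i , j , k , i<j , j<k , ik , kj) → proj₁ (av i j k i<j j<k) (ik , kj)) ,
  (λ (i , j , k , i<j , j<k , jk , ki) → proj₂ (av i j k i<j j<k) (jk , ki)) , refl

VertexSeq-resp : ∀ {n} {a b : Fin n → ℕ} → a ≗ b → VertexSeq a → VertexSeq b
VertexSeq-resp {a = a} {b} a≗b (inj , av) =
  (λ {i} {j} eq → inj (trans (a≗b i) (trans eq (sym (a≗b j))))) ,
  λ i j k i<j j<k → subst₃ (av i j k i<j j<k) (a≗b i) (a≗b j) (a≗b k)
  where
  subst₃ : ∀ {x y z x′ y′ z′} →
    ¬ (x ℕ.< z × z ℕ.< y) × ¬ (y ℕ.< z × z ℕ.< x) → x ≡ x′ → y ≡ y′ → z ≡ z′ →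
    ¬ (x′ ℕ.< z′ × z′ ℕ.< y′) × ¬ (y′ ℕ.< z′ × z′ ℕ.< x′)
  subst₃ h refl refl refl = h

VertexSeq-suc : ∀ {n} {a : Fin n → ℕ} → VertexSeq a → VertexSeq (λ i → suc (a i))
VertexSeq-suc (inj , av) = (λ eq → inj (ℕₚ.suc-injective eq)) ,
  λ i j k i<j j<k → (λ { (ℕ.s≤s ik , ℕ.s≤s kj) → proj₁ (av i j k i<j j<k) (ik , kj) }) ,
                    (λ { (ℕ.s≤s jk , ℕ.s≤s ki) → proj₂ (av i j k i<j j<k) (jk , ki) })

toℕ<n⇒inject₁ : ∀ {n} (i : Fin (suc n)) → toℕ i ℕ.< n → ∃[ i′ ] i ≡ inject₁ i′
toℕ<n⇒inject₁ i i<n with view i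
... | ‵fromℕ = ⊥-elim (ℕₚ.<-irrefl (Finₚ.toℕ-fromℕ _) i<n)
... | ‵inj₁ {i = i′} _ = i′ , refl

Extreme : ∀ {n} → (Fin n → ℕ) → ℕ → Set
Extreme a v = (∀ s → a s ℕ.< v) ⊎ (∀ s → v ℕ.< a s)

Extreme⇒≢ : ∀ {n} {a : Fin n → ℕ} {v} → Extreme a v → ∀ s → a s ≢ v
Extreme⇒≢ (inj₁ below) s as≡v = ℕₚ.<-irrefl as≡v (below s)
Extreme⇒≢ (inj₂ above) s as≡v = ℕₚ.<-irrefl (sym as≡v) (above s)

snoc-injective : ∀ {n} {a : Fin n → ℕ} {v} → Injective _≡_ _≡_ a → Extreme a v → Injective _≡_ _≡_ (snoc a v)
snoc-injective {n} {a} {v} inj extreme {i} {j} eq with view i | view j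
... | ‵fromℕ | ‵fromℕ = refl
... | ‵fromℕ | ‵inj₁ {i = j′} _ =
  ⊥-elim (Extreme⇒≢ extreme j′ (sym (trans (sym (snoc-fromℕ a v)) (trans eq (snoc-inject₁ a v j′)))))
... | ‵inj₁ {i = i′} _ | ‵fromℕ =
  ⊥-elim (Extreme⇒≢ extreme i′ (trans (sym (snoc-inject₁ a v i′)) (trans eq (snoc-fromℕ a v))))
... | ‵inj₁ {i = i′} _ | ‵inj₁ {i = j′} _ =
  cong inject₁ (inj (trans (sym (snoc-inject₁ a v i′)) (trans eq (snoc-inject₁ a v j′))))

snoc-avoids : ∀ {n} {a : Fin n → ℕ} {v} → Avoids a → Extreme a v → Avoids (snoc a v)
snoc-avoids {n} {a} {v} av extreme i j k i<j j<k with view k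
... | ‵inj₁ {i = k′} _ with toℕ<n⇒inject₁ j j<n | toℕ<n⇒inject₁ i (ℕₚ.<-trans i<j j<n)
  where
  j<n : toℕ j ℕ.< n
  j<n = ℕₚ.<-trans j<k (subst (ℕ._< n) (sym (Finₚ.toℕ-inject₁ k′)) (Finₚ.toℕ<n k′))
...   | j′ , refl | i′ , refl rewrite snoc-inject₁ a v i′ | snoc-inject₁ a v j′ | snoc-inject₁ a v k′ =
  av i′ j′ k′ (subst₂ ℕ._<_ (Finₚ.toℕ-inject₁ i′) (Finₚ.toℕ-inject₁ j′) i<j)
              (subst₂ ℕ._<_ (Finₚ.toℕ-inject₁ j′) (Finₚ.toℕ-inject₁ k′) j<k)
snoc-avoids {n} {a} {v} av extreme i j k i<j j<k | ‵fromℕ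
  with toℕ<n⇒inject₁ j j<n | toℕ<n⇒inject₁ i (ℕₚ.<-trans i<j j<n)
  where
  j<n : toℕ j ℕ.< n
  j<n = subst (toℕ j ℕ.<_) (Finₚ.toℕ-fromℕ n) j<k
...   | j′ , refl | i′ , refl rewrite snoc-inject₁ a v i′ | snoc-inject₁ a v j′ | snoc-fromℕ a v
  with extreme
...     | inj₁ below = (λ (_ , v<aj) → ℕₚ.<-asym v<aj (below j′)) , (λ (_ , v<ai) → ℕₚ.<-asym v<ai (below i′))
...     | inj₂ above = (λ (ai<v , _) → ℕₚ.<-asym ai<v (above i′)) , (λ (aj<v , _) → ℕₚ.<-asym aj<v (above j′))

snoc-VertexSeq : ∀ {n} {a : Fin n → ℕ} {v} → VertexSeq a → Extreme a v → VertexSeq (snoc a v)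
snoc-VertexSeq (inj , av) extreme = snoc-injective inj extreme , snoc-avoids av extreme

permTop : ∀ {n} → (Fin n → Fin n) → Fin (suc n) → Fin (suc n)
permTop {n} σ = snoc (λ i → inject₁ (σ i)) (fromℕ n)

permBottom : ∀ {n} → (Fin n → Fin n) → Fin (suc n) → Fin (suc n)
permBottom σ = snoc (λ i → suc (σ i)) zero

extendTop : ∀ {n} → Pt n → Pt (suc n)
extendTop {n} u = snoc u (ℕ→ℚ (suc n))

extendBottom : ∀ {n} → Pt n → Pt (suc n)
extendBottom u = snoc (λ j → u j + 1ℚ) 1ℚ

val-permTop : ∀ {n} (σ : Fin n → Fin n) → val (permTop σ) ≗ snoc (val σ) n
val-permTop {n} σ t = trans (snoc-map toℕ _ _ t) (snoc-cong (λ j → Finₚ.toℕ-inject₁ (σ j)) (Finₚ.toℕ-fromℕ n) t)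

val-permBottom : ∀ {n} (σ : Fin n → Fin n) → val (permBottom σ) ≗ snoc (λ j → suc (val σ j)) 0
val-permBottom σ = snoc-map toℕ _ _

permPt-permTop : ∀ {n} (σ : Fin n → Fin n) → permPt (permTop σ) ≗ extendTop (permPt σ)
permPt-permTop {n} σ t = trans (cong (λ z → ℕ→ℚ (suc z)) (val-permTop σ t)) (snoc-map (λ z → ℕ→ℚ (suc z)) (val σ) n t)

permPt-permBottom : ∀ {n} (σ : Fin n → Fin n) → permPt (permBottom σ) ≗ extendBottom (permPt σ)
permPt-permBottom σ t = begin
  ℕ→ℚ (suc (val (permBottom σ) t))                            ≡⟨ cong (λ z → ℕ→ℚ (suc z)) (val-permBottom σ t) ⟩
  ℕ→ℚ (suc (snoc (λ j → suc (val σ j)) 0 t))                   ≡⟨ snoc-map (λ z → ℕ→ℚ (suc z)) _ 0 t ⟩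
  snoc (λ j → ℕ→ℚ (suc (suc (val σ j)))) 1ℚ t
    ≡⟨ snoc-cong (λ j → trans (ℕ→ℚ-suc (suc (val σ j))) (+-comm 1ℚ (permPt σ j))) refl t ⟩
  extendBottom (permPt σ) t                                    ∎
  where open ≡-Reasoning

Vert-extendTop : ∀ {n} {y} → Vert n y → ∃[ z ] Vert (suc n) z × z ≗ extendTop y
Vert-extendTop v@((σ , _) , _ , _ , refl) =
  permPt (permTop σ) ,
  VertexSeq⇒Vert (permTop σ) (VertexSeq-resp (λ t → sym (val-permTop σ t))
    (snoc-VertexSeq (Vert⇒VertexSeq v) (inj₁ (λ s → Finₚ.toℕ<n (σ s))))) ,
  permPt-permTop σ

Vert-extendBottom : ∀ {n} {y} → Vert n y → ∃[ z ] Vert (suc n) z × z ≗ extendBottom y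
Vert-extendBottom v@((σ , _) , _ , _ , refl) =
  permPt (permBottom σ) ,
  VertexSeq⇒Vert (permBottom σ) (VertexSeq-resp (λ t → sym (val-permBottom σ t))
    (snoc-VertexSeq (VertexSeq-suc (Vert⇒VertexSeq v)) (inj₂ (λ s → ℕ.s≤s ℕ.z≤n)))) ,
  permPt-permBottom σ

lincomb-snoc : ∀ {m n} (w : Fin m → ℚ) (p : Fin m → Pt n) (a : Fin m → ℚ) →
  lincomb w (λ i → snoc (p i) (a i)) ≗ snoc (lincomb w p) (ΣF (λ i → w i * a i))
lincomb-snoc w p a t with view t
... | ‵fromℕ = trans (ΣF-cong (λ i → cong (w i *_) (snoc-fromℕ (p i) (a i)))) (sym (snoc-fromℕ (lincomb w p) _))
... | ‵inj₁ {i = s} _ = trans (ΣF-cong (λ i → cong (w i *_) (snoc-inject₁ (p i) (a i) s))) (sym (snoc-inject₁ (lincomb w p) _ s))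

extendTop-affine : ∀ {n} → Affine (extendTop {n})
extendTop-affine {n} w p Σw≡1 x≗ t =
  trans (lincomb-snoc w p (λ _ → ℕ→ℚ (suc n)) t) (snoc-cong x≗ (ΣF-weighted-const w (ℕ→ℚ (suc n)) Σw≡1) t)

extendBottom-affine : ∀ {n} → Affine (extendBottom {n})
extendBottom-affine w p {x} Σw≡1 x≗ t =
  trans (lincomb-snoc w (λ i j → p i j + 1ℚ) (λ _ → 1ℚ) t) (snoc-cong shifted (ΣF-weighted-const w 1ℚ Σw≡1) t)
  where
  shifted : lincomb w (λ i j → p i j + 1ℚ) ≗ (λ j → x j + 1ℚ)
  shifted j = begin
    ΣF (λ i → w i * (p i j + 1ℚ))               ≡⟨ ΣF-cong (λ i → *-distribˡ-+ (w i) (p i j) 1ℚ) ⟩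
    ΣF (λ i → w i * p i j + w i * 1ℚ)           ≡⟨ ΣF-+ (λ i → w i * p i j) (λ i → w i * 1ℚ) ⟩
    lincomb w p j + ΣF (λ i → w i * 1ℚ)         ≡⟨ cong₂ _+_ (x≗ j) (ΣF-weighted-const w 1ℚ Σw≡1) ⟩
    x j + 1ℚ                                    ∎
    where open ≡-Reasoning

P-extendTop : ∀ {n} {u} → P n u → P (suc n) (extendTop u)
P-extendTop {n} = Conv-map extendTop (extendTop-affine {n}) Vert-extendTop

P-extendBottom : ∀ {n} {u} → P n u → P (suc n) (extendBottom u)
P-extendBottom {n} = Conv-map {S = Vert n} {T = Vert (suc n)} extendBottom (extendBottom-affine {n}) (λ {y} → Vert-extendBottom {y = y})

C-suc : ∀ k → suc k C 2 ≡ k ℕ.+ k C 2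
C-suc k = trans (sym (nCk+nC[k+1]≡[n+1]C[k+1] k 1)) (cong (ℕ._+ k C 2) (nC1≡n k))

C-double : ∀ k → k C 2 ℕ.+ k C 2 ℕ.+ k ≡ k ℕ.* k
C-double zero = refl
C-double (suc k) rewrite C-suc k = begin
  k ℕ.+ X ℕ.+ (k ℕ.+ X) ℕ.+ suc k        ≡⟨ regroup k X ⟩
  X ℕ.+ X ℕ.+ k ℕ.+ (2 ℕ.* k ℕ.+ 1)      ≡⟨ cong (ℕ._+ (2 ℕ.* k ℕ.+ 1)) (C-double k) ⟩
  k ℕ.* k ℕ.+ (2 ℕ.* k ℕ.+ 1)            ≡⟨ square k ⟩
  suc k ℕ.* suc k                        ∎
  where
  open ≡-Reasoning
  X = k C 2
  regroup : ∀ k X → k ℕ.+ X ℕ.+ (k ℕ.+ X) ℕ.+ suc k ≡ X ℕ.+ X ℕ.+ k ℕ.+ (2 ℕ.* k ℕ.+ 1)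
  regroup = ℕ-Solver.solve-∀
  square : ∀ k → k ℕ.* k ℕ.+ (2 ℕ.* k ℕ.+ 1) ≡ suc k ℕ.* suc k
  square = ℕ-Solver.solve-∀

ℕ→ℚ-+-cancelˡ : ∀ A B → ℕ→ℚ (A ℕ.+ B) - ℕ→ℚ A ≡ ℕ→ℚ B
ℕ→ℚ-+-cancelˡ A B = trans (cong (_- ℕ→ℚ A) (ℕ→ℚ-+ A B)) (cancel (ℕ→ℚ A) (ℕ→ℚ B))
  where
  cancel : ∀ a b → a + b - a ≡ b
  cancel = solve-∀ ℚ-ring

ℕ→ℚ-+-cancelʳ : ∀ A B → ℕ→ℚ A - ℕ→ℚ (A ℕ.+ B) ≡ - ℕ→ℚ B
ℕ→ℚ-+-cancelʳ A B = trans (cong (λ z → ℕ→ℚ A - z) (ℕ→ℚ-+ A B)) (cancel (ℕ→ℚ A) (ℕ→ℚ B))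
  where
  cancel : ∀ a b → a - (a + b) ≡ - b
  cancel = solve-∀ ℚ-ring

injective⇒surjective : ∀ {n} (σ : Fin n → Fin n) → Injective _≡_ _≡_ σ → ∀ v → ∃[ i ] σ i ≡ v
injective⇒surjective {suc n} σ inj v with Finₚ.any? (λ i → σ i Finₚ.≟ v)
... | yes hit = hit
... | no miss = ⊥-elim (ℕₚ.<-irrefl refl (Finₚ.injective⇒≤ {f = avoid-v} avoid-v-injective))
  where
  avoid-v : Fin (suc n) → Fin n
  avoid-v i = punchOut {i = v} {j = σ i} (λ eq → miss (i , sym eq))
  avoid-v-injective : Injective _≡_ _≡_ avoid-v
  avoid-v-injective {x} {y} eq = inj (Finₚ.punchOut-injective (λ eq → miss (x , sym eq)) (λ eq → miss (y , sym eq)) eq)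

-- For a sequence a of distinct values 0, …, n-1 avoiding 132 and 312, every prefix
-- a₀ … aⱼ consists of consecutive values, so each new value is one more than the
-- current maximum or one less than the current minimum.
module VertexCoordinates {n} (a : Fin n → ℕ) (vs : VertexSeq a) (a<n : ∀ i → a i ℕ.< n)
         (onto : ∀ v → v ℕ.< n → ∃[ i ] a i ≡ v) where

  inj = proj₁ vs
  av = proj₂ vs

  x : Pt n
  x i = ℕ→ℚ (suc (a i))

  record Interval (j : ℕ) : Set where
    field
      lo : ℕ
      p q : Fin n
      p≤j : toℕ p ℕ.≤ j
      ap≡lo : a p ≡ lo
      q≤j : toℕ q ℕ.≤ j
      aq≡hi : a q ≡ lo ℕ.+ j
      bounds : ∀ i → toℕ i ℕ.≤ j → lo ℕ.≤ a i × a i ℕ.≤ lo ℕ.+ j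
      prefix≡ : prefix x (suc j) ≡ ℕ→ℚ (suc j ℕ.* suc lo ℕ.+ suc j C 2)

  module Next {j} (I : Interval j) (k : Fin n) (k≡1+j : toℕ k ≡ suc j) where
    open Interval I

    p<k : toℕ p ℕ.< toℕ k
    p<k = subst (toℕ p ℕ.<_) (sym k≡1+j) (ℕ.s≤s p≤j)

    q<k : toℕ q ℕ.< toℕ k
    q<k = subst (toℕ q ℕ.<_) (sym k≡1+j) (ℕ.s≤s q≤j)

    placement : ∀ r → toℕ r ℕ.≤ j ⊎ r ≡ k ⊎ toℕ k ℕ.< toℕ r
    placement r with ℕₚ.<-cmp (toℕ r) (suc j)
    ... | tri< r<1+j _ _ = inj₁ (ℕₚ.≤-pred r<1+j)
    ... | tri≈ _ r≡1+j _ = inj₂ (inj₁ (Finₚ.toℕ-injective (trans r≡1+j (sym k≡1+j))))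
    ... | tri> _ _ 1+j<r = inj₂ (inj₂ (subst (ℕ._< toℕ r) (sym k≡1+j) 1+j<r))

    not-inside : lo ℕ.≤ a k → a k ℕ.≤ lo ℕ.+ j → ⊥
    not-inside lo≤ak ak≤hi with ℕₚ.m≤n⇒m<n∨m≡n lo≤ak | ℕₚ.m≤n⇒m<n∨m≡n ak≤hi
    ... | inj₂ lo≡ak | _ = ℕₚ.<-irrefl (cong toℕ (inj (trans ap≡lo lo≡ak))) p<k
    ... | _ | inj₂ ak≡hi = ℕₚ.<-irrefl (cong toℕ (inj (trans aq≡hi (sym ak≡hi)))) q<k
    ... | inj₁ lo<ak | inj₁ ak<hi with ℕₚ.<-cmp (toℕ p) (toℕ q)
    ...   | tri< p<q _ _ = proj₁ (av p q k p<q q<k)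
                             (subst (ℕ._< a k) (sym ap≡lo) lo<ak , subst (a k ℕ.<_) (sym aq≡hi) ak<hi)
    ...   | tri≈ _ p≡q _ = ℕₚ.<-asym (subst (ℕ._< a k) (sym ap≡lo) lo<ak)
                             (subst (a k ℕ.<_) (trans (sym aq≡hi) (cong a (sym (Finₚ.toℕ-injective p≡q)))) ak<hi)
    ...   | tri> _ _ q<p = proj₂ (av q p k q<p p<k)
                             (subst (ℕ._< a k) (sym ap≡lo) lo<ak , subst (a k ℕ.<_) (sym aq≡hi) ak<hi)

    -- the value 1 + a k would have to occur after k, creating a 312 at positions p, k, r
    not-far-below : suc (a k) ℕ.< lo → ⊥
    not-far-below 2+ak≤lo with onto (suc (a k)) (ℕₚ.<-trans 2+ak≤lo (subst (ℕ._< n) ap≡lo (a<n p)))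
    ... | r , ar≡1+ak with placement r
    ...   | inj₁ r≤j = ℕₚ.<-irrefl refl (ℕₚ.<-≤-trans 2+ak≤lo (subst (lo ℕ.≤_) ar≡1+ak (proj₁ (bounds r r≤j))))
    ...   | inj₂ (inj₁ r≡k) = ℕₚ.<-irrefl (trans (cong a (sym r≡k)) ar≡1+ak) (ℕₚ.n<1+n (a k))
    ...   | inj₂ (inj₂ k<r) = proj₂ (av p k r p<k k<r)
                                (subst (a k ℕ.<_) (sym ar≡1+ak) ℕₚ.≤-refl , subst₂ ℕ._<_ (sym ar≡1+ak) (sym ap≡lo) 2+ak≤lo)

    -- the value lo + j + 1 would have to occur after k, creating a 132 at positions q, k, r
    not-far-above : suc (lo ℕ.+ j) ℕ.< a k → ⊥
    not-far-above hi+1<ak with onto (suc (lo ℕ.+ j)) (ℕₚ.<-trans hi+1<ak (a<n k))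
    ... | r , ar≡hi+1 with placement r
    ...   | inj₁ r≤j = ℕₚ.<-irrefl refl (ℕₚ.<-≤-trans (subst (lo ℕ.+ j ℕ.<_) (sym ar≡hi+1) ℕₚ.≤-refl) (proj₂ (bounds r r≤j)))
    ...   | inj₂ (inj₁ r≡k) = ℕₚ.<-irrefl (sym (trans (cong a (sym r≡k)) ar≡hi+1)) hi+1<ak
    ...   | inj₂ (inj₂ k<r) = proj₁ (av q k r q<k k<r)
                                (subst₂ ℕ._<_ (sym aq≡hi) (sym ar≡hi+1) ℕₚ.≤-refl , subst (ℕ._< a k) (sym ar≡hi+1) hi+1<ak)

    next-value : a k ≡ suc (lo ℕ.+ j) ⊎ suc (a k) ≡ lo
    next-value with ℕₚ.<-cmp (a k) lo
    ... | tri< ak<lo _ _ = [ (λ 1+ak<lo → ⊥-elim (not-far-below 1+ak<lo)) , inj₂ ]′ (ℕₚ.m≤n⇒m<n∨m≡n ak<lo)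
    ... | tri≈ _ ak≡lo _ =
      ⊥-elim (not-inside (ℕₚ.≤-reflexive (sym ak≡lo)) (subst (ℕ._≤ lo ℕ.+ j) (sym ak≡lo) (ℕₚ.m≤m+n lo j)))
    ... | tri> _ _ lo<ak with ℕₚ.≤-<-connex (a k) (lo ℕ.+ j)
    ...   | inj₁ ak≤hi = ⊥-elim (not-inside (ℕₚ.<⇒≤ lo<ak) ak≤hi)
    ...   | inj₂ hi<ak = [ (λ hi+1<ak → ⊥-elim (not-far-above hi+1<ak)) , (λ eq → inj₁ (sym eq)) ]′ (ℕₚ.m≤n⇒m<n∨m≡n hi<ak)

  prefix-at : ∀ {j} (k : Fin n) → toℕ k ≡ j → prefix x (suc j) ≡ prefix x j + x k
  prefix-at k refl = prefix-suc x k

  prefix-grow : ∀ {j} (I : Interval j) (k : Fin n) → toℕ k ≡ suc j →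
    prefix x (suc (suc j)) ≡ ℕ→ℚ (suc j ℕ.* suc (Interval.lo I) ℕ.+ suc j C 2 ℕ.+ suc (a k))
  prefix-grow {j} I k k≡1+j = begin
    prefix x (suc (suc j))                     ≡⟨ prefix-at k k≡1+j ⟩
    prefix x (suc j) + x k                     ≡⟨ cong (_+ x k) (Interval.prefix≡ I) ⟩
    ℕ→ℚ (suc j ℕ.* suc (Interval.lo I) ℕ.+ suc j C 2) + x k
                                               ≡⟨ ℕ→ℚ-+ (suc j ℕ.* suc (Interval.lo I) ℕ.+ suc j C 2) (suc (a k)) ⟨
    ℕ→ℚ (suc j ℕ.* suc (Interval.lo I) ℕ.+ suc j C 2 ℕ.+ suc (a k)) ∎
    where open ≡-Reasoning

  ≤1+j-split : ∀ {j} (k : Fin n) → toℕ k ≡ suc j → ∀ i → toℕ i ℕ.≤ suc j → toℕ i ℕ.≤ j ⊎ i ≡ k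
  ≤1+j-split k k≡1+j i i≤1+j with ℕₚ.m≤n⇒m<n∨m≡n i≤1+j
  ... | inj₁ i<1+j = inj₁ (ℕₚ.≤-pred i<1+j)
  ... | inj₂ i≡1+j = inj₂ (Finₚ.toℕ-injective (trans i≡1+j (sym k≡1+j)))

  grow-up : ∀ {j} (I : Interval j) (k : Fin n) → toℕ k ≡ suc j →
    a k ≡ suc (Interval.lo I ℕ.+ j) → Interval (suc j)
  grow-up {j} I k k≡1+j ak≡hi+1 = record
    { lo = lo ; p = p ; q = k ; p≤j = ℕₚ.m≤n⇒m≤1+n p≤j ; ap≡lo = ap≡lo ; q≤j = ℕₚ.≤-reflexive k≡1+j
    ; aq≡hi = trans ak≡hi+1 (sym (ℕₚ.+-suc lo j)) ; bounds = bounds′ ; prefix≡ = prefix≡′ }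
    where
    open Interval I
    bounds′ : ∀ i → toℕ i ℕ.≤ suc j → lo ℕ.≤ a i × a i ℕ.≤ lo ℕ.+ suc j
    bounds′ i i≤1+j with ≤1+j-split k k≡1+j i i≤1+j
    ... | inj₁ i≤j = proj₁ (bounds i i≤j) , ℕₚ.≤-trans (proj₂ (bounds i i≤j)) (ℕₚ.+-monoʳ-≤ lo (ℕₚ.n≤1+n j))
    ... | inj₂ refl = subst (lo ℕ.≤_) (sym ak≡hi+1) (ℕₚ.m≤n⇒m≤1+n (ℕₚ.m≤m+n lo j)) ,
                      ℕₚ.≤-reflexive (trans ak≡hi+1 (sym (ℕₚ.+-suc lo j)))
    regroup : ∀ j lo X → suc j ℕ.* suc lo ℕ.+ X ℕ.+ suc (suc (lo ℕ.+ j)) ≡ suc (suc j) ℕ.* suc lo ℕ.+ (suc j ℕ.+ X)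
    regroup = ℕ-Solver.solve-∀
    prefix≡′ : prefix x (suc (suc j)) ≡ ℕ→ℚ (suc (suc j) ℕ.* suc lo ℕ.+ suc (suc j) C 2)
    prefix≡′ = trans (prefix-grow I k k≡1+j) (cong ℕ→ℚ (begin
      suc j ℕ.* suc lo ℕ.+ suc j C 2 ℕ.+ suc (a k)               ≡⟨ cong (λ z → suc j ℕ.* suc lo ℕ.+ suc j C 2 ℕ.+ suc z) ak≡hi+1 ⟩
      suc j ℕ.* suc lo ℕ.+ suc j C 2 ℕ.+ suc (suc (lo ℕ.+ j))    ≡⟨ regroup j lo (suc j C 2) ⟩
      suc (suc j) ℕ.* suc lo ℕ.+ (suc j ℕ.+ suc j C 2)           ≡⟨ cong (suc (suc j) ℕ.* suc lo ℕ.+_) (C-suc (suc j)) ⟨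
      suc (suc j) ℕ.* suc lo ℕ.+ suc (suc j) C 2                 ∎))
      where open ≡-Reasoning

  grow-down : ∀ {j} (I : Interval j) (k : Fin n) → toℕ k ≡ suc j →
    suc (a k) ≡ Interval.lo I → Interval (suc j)
  grow-down {j} I k k≡1+j 1+ak≡lo = record
    { lo = a k ; p = k ; q = q ; p≤j = ℕₚ.≤-reflexive k≡1+j ; ap≡lo = refl ; q≤j = ℕₚ.m≤n⇒m≤1+n q≤j
    ; aq≡hi = trans aq≡hi hi≡ ; bounds = bounds′ ; prefix≡ = prefix≡′ }
    where
    open Interval I
    hi≡ : lo ℕ.+ j ≡ a k ℕ.+ suc j
    hi≡ = trans (cong (ℕ._+ j) (sym 1+ak≡lo)) (sym (ℕₚ.+-suc (a k) j))
    bounds′ : ∀ i → toℕ i ℕ.≤ suc j → a k ℕ.≤ a i × a i ℕ.≤ a k ℕ.+ suc j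
    bounds′ i i≤1+j with ≤1+j-split k k≡1+j i i≤1+j
    ... | inj₁ i≤j = ℕₚ.<⇒≤ (subst (ℕ._≤ a i) (sym 1+ak≡lo) (proj₁ (bounds i i≤j))) ,
                     subst (a i ℕ.≤_) hi≡ (proj₂ (bounds i i≤j))
    ... | inj₂ refl = ℕₚ.≤-refl , ℕₚ.m≤m+n (a k) (suc j)
    regroup : ∀ j m X → suc j ℕ.* suc (suc m) ℕ.+ X ℕ.+ suc m ≡ suc (suc j) ℕ.* suc m ℕ.+ (suc j ℕ.+ X)
    regroup = ℕ-Solver.solve-∀
    prefix≡′ : prefix x (suc (suc j)) ≡ ℕ→ℚ (suc (suc j) ℕ.* suc (a k) ℕ.+ suc (suc j) C 2)
    prefix≡′ = trans (prefix-grow I k k≡1+j) (cong ℕ→ℚ (begin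
      suc j ℕ.* suc lo ℕ.+ suc j C 2 ℕ.+ suc (a k)                 ≡⟨ cong (λ z → suc j ℕ.* suc z ℕ.+ suc j C 2 ℕ.+ suc (a k)) 1+ak≡lo ⟨
      suc j ℕ.* suc (suc (a k)) ℕ.+ suc j C 2 ℕ.+ suc (a k)        ≡⟨ regroup j (a k) (suc j C 2) ⟩
      suc (suc j) ℕ.* suc (a k) ℕ.+ (suc j ℕ.+ suc j C 2)          ≡⟨ cong (suc (suc j) ℕ.* suc (a k) ℕ.+_) (C-suc (suc j)) ⟨
      suc (suc j) ℕ.* suc (a k) ℕ.+ suc (suc j) C 2                ∎))
      where open ≡-Reasoning

  position : ∀ j → j ℕ.< n → ∃[ k ] toℕ k ≡ j
  position j j<n = Fin.fromℕ< j<n , Finₚ.toℕ-fromℕ< j<n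

  interval : ∀ j → j ℕ.< n → Interval j
  interval zero 0<n with position 0 0<n
  ... | k , k≡0 = record
    { lo = a k ; p = k ; q = k ; p≤j = ℕₚ.≤-reflexive k≡0 ; ap≡lo = refl ; q≤j = ℕₚ.≤-reflexive k≡0
    ; aq≡hi = sym (ℕₚ.+-identityʳ (a k)) ; bounds = bounds ; prefix≡ = prefix≡ }
    where
    bounds : ∀ i → toℕ i ℕ.≤ 0 → a k ℕ.≤ a i × a i ℕ.≤ a k ℕ.+ 0
    bounds i i≤0 with Finₚ.toℕ-injective {i = i} {j = k} (trans (ℕₚ.n≤0⇒n≡0 i≤0) (sym k≡0))
    ... | refl = ℕₚ.≤-refl , ℕₚ.m≤m+n (a k) 0
    one-term : ∀ m → suc m ≡ 1 ℕ.* suc m ℕ.+ 0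
    one-term = ℕ-Solver.solve-∀
    prefix≡ : prefix x 1 ≡ ℕ→ℚ (1 ℕ.* suc (a k) ℕ.+ 1 C 2)
    prefix≡ = trans (prefix-at k k≡0)
      (trans (cong (_+ x k) (prefix-0 x)) (trans (+-identityˡ (x k)) (cong ℕ→ℚ (one-term (a k)))))
  interval (suc j) 1+j<n =
    [ grow-up I k k≡1+j , grow-down I k k≡1+j ]′ (Next.next-value I k k≡1+j)
    where
    I = interval j (ℕₚ.<-trans (ℕₚ.n<1+n j) 1+j<n)
    k = proj₁ (position (suc j) 1+j<n)
    k≡1+j = proj₂ (position (suc j) 1+j<n)

  ΣF-x : ∀ j → suc j ≡ n → ΣF x ≡ ℕ→ℚ (suc n C 2)
  ΣF-x j 1+j≡n = begin
    ΣF x                                          ≡⟨ prefix-full x (suc j) (ℕₚ.≤-reflexive (sym 1+j≡n)) ⟨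
    prefix x (suc j)                              ≡⟨ prefix≡ ⟩
    ℕ→ℚ (suc j ℕ.* suc lo ℕ.+ suc j C 2)          ≡⟨ cong (λ m → ℕ→ℚ (suc j ℕ.* suc m ℕ.+ suc j C 2)) lo≡0 ⟩
    ℕ→ℚ (suc j ℕ.* 1 ℕ.+ suc j C 2)               ≡⟨ cong ℕ→ℚ (trans (cong (ℕ._+ suc j C 2) (ℕₚ.*-identityʳ (suc j))) (sym (C-suc (suc j)))) ⟩
    ℕ→ℚ (suc (suc j) C 2)                         ≡⟨ cong (λ m → ℕ→ℚ (suc m C 2)) 1+j≡n ⟩
    ℕ→ℚ (suc n C 2)                               ∎
    where
    open ≡-Reasoning
    open Interval (interval j (subst (j ℕ.<_) 1+j≡n ℕₚ.≤-refl))
    zero-at = onto 0 (subst (0 ℕ.<_) 1+j≡n (ℕ.s≤s ℕ.z≤n))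
    r = proj₁ zero-at
    r≤j : toℕ r ℕ.≤ j
    r≤j = ℕₚ.≤-pred (subst (toℕ r ℕ.<_) (sym 1+j≡n) (Finₚ.toℕ<n r))
    lo≡0 : lo ≡ 0
    lo≡0 = ℕₚ.n≤0⇒n≡0 (subst (lo ℕ.≤_) (proj₂ zero-at) (proj₁ (bounds r r≤j)))

  module _ {j} (I : Interval j) (k : Fin n) (k≡1+j : toℕ k ≡ suc j) where
    open Interval I

    L-x : L k x ≡ ℕ→ℚ (suc j ℕ.* suc lo ℕ.+ suc j C 2) - ℕ→ℚ (suc j ℕ.* suc (a k))
    L-x = trans (L≡prefix k x) (trans (cong (λ m → prefix x m - ℕ→ℚ m * x k) k≡1+j)
            (cong₂ _-_ prefix≡ (sym (ℕ→ℚ-* (suc j) (suc (a k))))))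

    L-x-up : a k ≡ suc (lo ℕ.+ j) → L k x ≡ - ℕ→ℚ (suc (suc j) C 2)
    L-x-up ak≡hi+1 = trans L-x (trans (cong (λ m → ℕ→ℚ A - ℕ→ℚ m) over) (ℕ→ℚ-+-cancelʳ A (suc (suc j) C 2)))
      where
      open ≡-Reasoning
      A = suc j ℕ.* suc lo ℕ.+ suc j C 2
      X = suc j C 2
      expand : ∀ j lo → suc j ℕ.* suc (suc (lo ℕ.+ j)) ≡ suc j ℕ.* suc lo ℕ.+ suc j ℕ.* suc j
      expand = ℕ-Solver.solve-∀
      regroup : ∀ j lo X → suc j ℕ.* suc lo ℕ.+ (X ℕ.+ X ℕ.+ suc j) ≡ suc j ℕ.* suc lo ℕ.+ X ℕ.+ (suc j ℕ.+ X)
      regroup = ℕ-Solver.solve-∀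
      over : suc j ℕ.* suc (a k) ≡ A ℕ.+ suc (suc j) C 2
      over = begin
        suc j ℕ.* suc (a k)                               ≡⟨ cong (λ z → suc j ℕ.* suc z) ak≡hi+1 ⟩
        suc j ℕ.* suc (suc (lo ℕ.+ j))                    ≡⟨ expand j lo ⟩
        suc j ℕ.* suc lo ℕ.+ suc j ℕ.* suc j              ≡⟨ cong (suc j ℕ.* suc lo ℕ.+_) (C-double (suc j)) ⟨
        suc j ℕ.* suc lo ℕ.+ (X ℕ.+ X ℕ.+ suc j)          ≡⟨ regroup j lo X ⟩
        A ℕ.+ (suc j ℕ.+ X)                               ≡⟨ cong (A ℕ.+_) (C-suc (suc j)) ⟨
        A ℕ.+ suc (suc j) C 2                             ∎

    L-x-down : suc (a k) ≡ lo → L k x ≡ ℕ→ℚ (suc (suc j) C 2)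
    L-x-down 1+ak≡lo = begin
      L k x                                                    ≡⟨ L-x ⟩
      ℕ→ℚ (suc j ℕ.* suc lo ℕ.+ X) - ℕ→ℚ (suc j ℕ.* suc (a k)) ≡⟨ cong₂ (λ m m′ → ℕ→ℚ m - ℕ→ℚ (suc j ℕ.* m′)) under 1+ak≡lo ⟩
      ℕ→ℚ (suc j ℕ.* lo ℕ.+ C₂) - ℕ→ℚ (suc j ℕ.* lo)         ≡⟨ ℕ→ℚ-+-cancelˡ (suc j ℕ.* lo) C₂ ⟩
      ℕ→ℚ C₂                                                   ∎
      where
      open ≡-Reasoning
      X = suc j C 2
      C₂ = suc (suc j) C 2
      regroup : ∀ j lo X → suc j ℕ.* suc lo ℕ.+ X ≡ suc j ℕ.* lo ℕ.+ (suc j ℕ.+ X)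
      regroup = ℕ-Solver.solve-∀
      under : suc j ℕ.* suc lo ℕ.+ X ≡ suc j ℕ.* lo ℕ.+ C₂
      under = trans (regroup j lo X) (cong (suc j ℕ.* lo ℕ.+_) (sym (C-suc (suc j))))

    ∣L-x∣ : ∣ L k x ∣ ≡ ℕ→ℚ (suc (suc j) C 2)
    ∣L-x∣ = [ (λ up → trans (cong ∣_∣ (L-x-up up)) (trans (∣-p∣≡∣p∣ C₂) ∣C₂∣≡C₂))
            , (λ down → trans (cong ∣_∣ (L-x-down down)) ∣C₂∣≡C₂) ]′ (Next.next-value I k k≡1+j)
      where
      C₂ = ℕ→ℚ (suc (suc j) C 2)
      ∣C₂∣≡C₂ : ∣ C₂ ∣ ≡ C₂
      ∣C₂∣≡C₂ = 0≤p⇒∣p∣≡p (ℕ→ℚ-nonNeg (suc (suc j) C 2))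

  ∣L∣-x : ∀ k j → toℕ k ≡ suc j → ∣ L k x ∣ ≡ ℕ→ℚ (suc (toℕ k) C 2)
  ∣L∣-x k j k≡1+j = subst (λ m → ∣ L k x ∣ ≡ ℕ→ℚ (suc m C 2)) (sym k≡1+j)
    (∣L-x∣ (interval j (ℕₚ.<-trans (subst (j ℕ.<_) (sym k≡1+j) ℕₚ.≤-refl) (Finₚ.toℕ<n k))) k k≡1+j)

val-onto : ∀ {n} (σ : Fin n → Fin n) → Injective _≡_ _≡_ σ → ∀ v → v ℕ.< n → ∃[ i ] val σ i ≡ v
val-onto σ σ-inj v v<n with injective⇒surjective σ σ-inj (Fin.fromℕ< v<n)
... | i , σi≡ = i , trans (cong toℕ σi≡) (Finₚ.toℕ-fromℕ< v<n)

vertex-equalities : ∀ {n} {x} → Vert n x →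
  (ΣF x ≡ ℕ→ℚ (suc n C 2)) × (∀ (k : Fin n) → 1 ℕ.≤ toℕ k → ∣ L k x ∣ ≡ ℕ→ℚ (suc (toℕ k) C 2))
vertex-equalities {zero} _ = refl , λ ()
vertex-equalities {suc n} v@((σ , σ-inj) , _ , _ , refl) =
  ΣF-x n refl , λ { k 1≤k → ∣L∣-x k (ℕ.pred (toℕ k)) (sym (ℕₚ.suc-pred (toℕ k) {{ℕ.>-nonZero 1≤k}})) }
  where
  open VertexCoordinates (val σ) (Vert⇒VertexSeq v) (λ i → Finₚ.toℕ<n (σ i)) (val-onto σ σ-inj)

-- The inequality description

Constraints : ∀ n → Pt n → Set
Constraints n x = (ΣF x ≡ ℕ→ℚ (suc n C 2))
  × ((k : Fin n) → 1 ℕ.≤ toℕ k → ∣ L k x ∣ ≤ ℕ→ℚ (suc (toℕ k) C 2))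

P⇒Constraints : ∀ {n} {x} → P n x → Constraints n x
P⇒Constraints {n} {x} x∈P = sum≡ , ∣L∣≤
  where
  sum≡ : ΣF x ≡ ℕ→ℚ (suc n C 2)
  sum≡ = trans (ΣF≡dot-1 x) (Conv-dot-≡ (λ _ → 1ℚ) _
    (λ {y} v → trans (sym (ΣF≡dot-1 y)) (proj₁ (vertex-equalities {x = y} v))) x∈P)
  ∣L∣≤ : ∀ k → 1 ℕ.≤ toℕ k → ∣ L k x ∣ ≤ ℕ→ℚ (suc (toℕ k) C 2)
  ∣L∣≤ k 1≤k = subst (_≤ _) (cong ∣_∣ (sym (L≡dot-α k x))) (Conv-∣dot∣≤ (α k) _
    (λ {y} v → ≤-reflexive (trans (cong ∣_∣ (sym (L≡dot-α k y))) (proj₂ (vertex-equalities {x = y} v) k 1≤k))) x∈P)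

P-0 : ∀ x → P 0 x
P-0 x = 1 , (λ _ → 1ℚ) , (λ _ → permPt id₀) , (λ _ → VertexSeq⇒Vert id₀ ((λ { {()} }) , λ ())) ,
        (λ _ → ℕ→ℚ-nonNeg 1) , +-identityʳ 1ℚ , λ ()
  where
  id₀ : Fin 0 → Fin 0
  id₀ ()

-- x is the mix of extendTop u and extendBottom u for a point u satisfying the constraints
-- one dimension lower; the weight is read off the last coordinate, c = weight · n + 1.
module Peel {n′} (x : Pt (suc (suc n′))) (cs : Constraints (suc (suc n′)) x) where
  ΣF≡ = proj₁ cs
  ∣L∣≤ = proj₂ cs
  n = suc n′
  y : Pt n
  y s = x (inject₁ s)
  c = x (fromℕ n)
  N = ℕ→ℚ n
  M = ℕ→ℚ (suc n)
  K = ℕ→ℚ (suc n C 2)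

  M≡1+N : M ≡ 1ℚ + N
  M≡1+N = ℕ→ℚ-suc n

  K+K+M≡M*M : K + K + M ≡ M * M
  K+K+M≡M*M = trans (sym (trans (ℕ→ℚ-+ (suc n C 2 ℕ.+ suc n C 2) (suc n)) (cong (_+ M) (ℕ→ℚ-+ (suc n C 2) (suc n C 2)))))
                    (trans (cong ℕ→ℚ (C-double (suc n))) (ℕ→ℚ-* (suc n) (suc n)))

  ΣF-y : ΣF y ≡ M + K - c
  ΣF-y = begin
    ΣF y                     ≡⟨ cancel (ΣF y) c ⟩
    ΣF y + c - c             ≡⟨ cong (_- c) (ΣF-init-last x) ⟨
    ΣF x - c                 ≡⟨ cong (_- c) ΣF≡ ⟩
    ℕ→ℚ (suc (suc n) C 2) - c ≡⟨ cong (λ m → ℕ→ℚ m - c) (C-suc (suc n)) ⟩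
    ℕ→ℚ (suc n ℕ.+ suc n C 2) - c ≡⟨ cong (_- c) (ℕ→ℚ-+ (suc n) (suc n C 2)) ⟩
    M + K - c                ∎
    where
    open ≡-Reasoning
    cancel : ∀ a c → a ≡ a + c - c
    cancel = solve-∀ ℚ-ring

  L-last : L (fromℕ n) x ≡ M + K - c - N * c
  L-last = trans (L-cong (fromℕ n) (snoc-init-last x)) (trans (L-snoc-fromℕ y c) (cong (_- N * c) ΣF-y))

  ∣L-last∣≤K : ∣ L (fromℕ n) x ∣ ≤ K
  ∣L-last∣≤K = subst (λ m → ∣ L (fromℕ n) x ∣ ≤ ℕ→ℚ (suc m C 2)) (Finₚ.toℕ-fromℕ n)
    (∣L∣≤ (fromℕ n) (subst (1 ℕ.≤_) (sym (Finₚ.toℕ-fromℕ n)) (ℕ.s≤s ℕ.z≤n)))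

  0≤c-1 : 0ℚ ≤ c - 1ℚ
  0≤c-1 = ℕ→ℚ-suc-*-nonNeg⁻¹ n (subst (0ℚ ≤_) K-L≡ (p≤q⇒0≤q-p (≤-trans (p≤∣p∣ _) ∣L-last∣≤K)))
    where
    identity : ∀ K N c → K - ((1ℚ + N) + K - c - N * c) ≡ (1ℚ + N) * (c - 1ℚ)
    identity = solve-∀ ℚ-ring
    K-L≡ : K - L (fromℕ n) x ≡ M * (c - 1ℚ)
    K-L≡ = begin
      K - L (fromℕ n) x                       ≡⟨ cong (λ z → K - z) L-last ⟩
      K - (M + K - c - N * c)                 ≡⟨ cong (λ m → K - (m + K - c - N * c)) M≡1+N ⟩
      K - ((1ℚ + N) + K - c - N * c)          ≡⟨ identity K N c ⟩
      (1ℚ + N) * (c - 1ℚ)                     ≡⟨ cong (_* (c - 1ℚ)) M≡1+N ⟨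
      M * (c - 1ℚ)                            ∎
      where open ≡-Reasoning

  0≤M-c : 0ℚ ≤ M - c
  0≤M-c = ℕ→ℚ-suc-*-nonNeg⁻¹ n (subst (0ℚ ≤_) K+L≡ (p≤q⇒0≤q-p (≤-trans (-p≤∣p∣ _) ∣L-last∣≤K)))
    where
    identity : ∀ K M c → K - - (M + K - c - (M - 1ℚ) * c) ≡ (K + K + M) - M * c
    identity = solve-∀ ℚ-ring
    factor : ∀ M c → M * M - M * c ≡ M * (M - c)
    factor = solve-∀ ℚ-ring
    N≡M-1 : N ≡ M - 1ℚ
    N≡M-1 = trans (add-sub N) (cong (_- 1ℚ) (sym M≡1+N))
      where
      add-sub : ∀ N → N ≡ 1ℚ + N - 1ℚ
      add-sub = solve-∀ ℚ-ring
    K+L≡ : K - - L (fromℕ n) x ≡ M * (M - c)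
    K+L≡ = begin
      K - - L (fromℕ n) x                     ≡⟨ cong (λ z → K - - z) L-last ⟩
      K - - (M + K - c - N * c)               ≡⟨ cong (λ z → K - - (M + K - c - z * c)) N≡M-1 ⟩
      K - - (M + K - c - (M - 1ℚ) * c)        ≡⟨ identity K M c ⟩
      (K + K + M) - M * c                     ≡⟨ cong (_- M * c) K+K+M≡M*M ⟩
      M * M - M * c                           ≡⟨ factor M c ⟩
      M * (M - c)                             ∎
      where open ≡-Reasoning

  weight : ℚ
  weight = (c - 1ℚ) * 1/ℕ→ℚ-suc n′

  N*weight : N * weight ≡ c - 1ℚ
  N*weight = begin
    N * ((c - 1ℚ) * 1/ℕ→ℚ-suc n′)       ≡⟨ rotate N (c - 1ℚ) (1/ℕ→ℚ-suc n′) ⟩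
    (c - 1ℚ) * (N * 1/ℕ→ℚ-suc n′)       ≡⟨ cong ((c - 1ℚ) *_) (ℕ→ℚ-suc-*-inverse n′) ⟩
    (c - 1ℚ) * 1ℚ                       ≡⟨ *-identityʳ (c - 1ℚ) ⟩
    c - 1ℚ                              ∎
    where
    open ≡-Reasoning
    rotate : ∀ a b i → a * (b * i) ≡ b * (a * i)
    rotate = solve-∀ ℚ-ring

  0≤weight : 0ℚ ≤ weight
  0≤weight = nonNeg-* 0≤c-1 (1/ℕ→ℚ-suc-nonNeg n′)

  weight≤1 : weight ≤ 1ℚ
  weight≤1 = 0≤q-p⇒p≤q (subst (0ℚ ≤_) (sym 1-weight≡) (nonNeg-* 0≤M-c (1/ℕ→ℚ-suc-nonNeg n′)))
    where
    regroup : ∀ N c i → N * i - (c - 1ℚ) * i ≡ (1ℚ + N - c) * i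
    regroup = solve-∀ ℚ-ring
    1-weight≡ : 1ℚ - weight ≡ (M - c) * 1/ℕ→ℚ-suc n′
    1-weight≡ = trans (cong (_- weight) (sym (ℕ→ℚ-suc-*-inverse n′)))
      (trans (regroup N c (1/ℕ→ℚ-suc n′)) (cong (λ z → (z - c) * 1/ℕ→ℚ-suc n′) (sym M≡1+N)))

  u : Pt n
  u s = y s - (1ℚ - weight)

  u-constraints : Constraints n u
  u-constraints = ΣF-u , ∣L∣≤-u
    where
    ΣF-u : ΣF u ≡ K
    ΣF-u = begin
      ΣF u                                          ≡⟨ ΣF-- y (λ _ → 1ℚ - weight) ⟩
      ΣF y - ΣF {n} (λ _ → 1ℚ - weight)             ≡⟨ cong₂ _-_ ΣF-y (ΣF-const {n} (1ℚ - weight)) ⟩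
      M + K - c - N * (1ℚ - weight)                 ≡⟨ cong (λ z → M + K - c - z) (trans (*-distrib-1- N weight) (cong (λ z → N - z) N*weight)) ⟩
      M + K - c - (N - (c - 1ℚ))                    ≡⟨ cong (λ z → z + K - c - (N - (c - 1ℚ))) M≡1+N ⟩
      (1ℚ + N) + K - c - (N - (c - 1ℚ))             ≡⟨ collapse N K c ⟩
      K                                             ∎
      where
      open ≡-Reasoning
      *-distrib-1- : ∀ N l → N * (1ℚ - l) ≡ N - N * l
      *-distrib-1- = solve-∀ ℚ-ring
      collapse : ∀ N K c → (1ℚ + N) + K - c - (N - (c - 1ℚ)) ≡ K
      collapse = solve-∀ ℚ-ring
    ∣L∣≤-u : (k : Fin n) → 1 ℕ.≤ toℕ k → ∣ L k u ∣ ≤ ℕ→ℚ (suc (toℕ k) C 2)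
    ∣L∣≤-u k 1≤k = subst₂ (λ l m → ∣ l ∣ ≤ ℕ→ℚ (suc m C 2)) L-inject₁ (Finₚ.toℕ-inject₁ k)
                     (∣L∣≤ (inject₁ k) (subst (1 ℕ.≤_) (sym (Finₚ.toℕ-inject₁ k)) 1≤k))
      where
      L-inject₁ : L (inject₁ k) x ≡ L k u
      L-inject₁ = trans (L-cong (inject₁ k) (snoc-init-last x))
        (trans (L-snoc-inject₁ k y c) (sym (L-shift k y (- (1ℚ - weight)))))

  x≗mix : x ≗ mix weight (extendTop u) (extendBottom u)
  x≗mix t = begin
    x t                                                       ≡⟨ snoc-init-last x t ⟩
    snoc y c t                                                ≡⟨ snoc-cong init≡ last≡ t ⟩
    snoc (mix weight u (λ j → u j + 1ℚ)) (weight * M + (1ℚ - weight) * 1ℚ) t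
                                                              ≡⟨ mix-snoc weight u M (λ j → u j + 1ℚ) 1ℚ t ⟨
    mix weight (extendTop u) (extendBottom u) t               ∎
    where
    open ≡-Reasoning
    shift-back : ∀ a l → a ≡ l * (a - (1ℚ - l)) + (1ℚ - l) * (a - (1ℚ - l) + 1ℚ)
    shift-back = solve-∀ ℚ-ring
    init≡ : y ≗ mix weight u (λ j → u j + 1ℚ)
    init≡ s = shift-back (y s) weight
    regroup : ∀ l N → l * N + 1ℚ ≡ l * (1ℚ + N) + (1ℚ - l) * 1ℚ
    regroup = solve-∀ ℚ-ring
    sub-add : ∀ c → c ≡ c - 1ℚ + 1ℚ
    sub-add = solve-∀ ℚ-ring
    last≡ : c ≡ weight * M + (1ℚ - weight) * 1ℚ
    last≡ = begin
      c                                     ≡⟨ sub-add c ⟩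
      c - 1ℚ + 1ℚ                           ≡⟨ cong (_+ 1ℚ) (trans (sym N*weight) (*-comm N weight)) ⟩
      weight * N + 1ℚ                       ≡⟨ regroup weight N ⟩
      weight * (1ℚ + N) + (1ℚ - weight) * 1ℚ ≡⟨ cong (λ z → weight * z + (1ℚ - weight) * 1ℚ) M≡1+N ⟨
      weight * M + (1ℚ - weight) * 1ℚ       ∎

  P-x : P n u → P (suc n) x
  P-x u∈P = Conv-resp {S = Vert (suc n)} (λ t → sym (x≗mix t))
    (Conv-mix {S = Vert (suc n)} 0≤weight weight≤1 (P-extendTop u∈P) (P-extendBottom u∈P))

Constraints⇒P : ∀ n {x} → Constraints n x → P n x
Constraints⇒P zero {x} _ = P-0 x
Constraints⇒P (suc zero) {x} (ΣF≡ , _) = Conv-resp {S = Vert 1} x₀≡1 (P-extendTop (P-0 (λ ())))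
  where
  x₀≡1 : extendTop {0} (λ ()) ≗ x
  x₀≡1 zero = sym (trans (sym (+-identityʳ (x zero))) ΣF≡)
Constraints⇒P (suc (suc n′)) {x} cs = Peel.P-x x cs (Constraints⇒P (suc n′) (Peel.u-constraints x cs))


-- Dimension

≡∨punchIn : ∀ {m} (s t : Fin (suc m)) → t ≡ s ⊎ ∃[ t′ ] t ≡ punchIn s t′
≡∨punchIn s t with s Finₚ.≟ t
... | yes s≡t = inj₁ (sym s≡t)
... | no s≢t = inj₂ (punchOut s≢t , sym (Finₚ.punchIn-punchOut s≢t))

LinDep : ∀ {k m} → (Fin k → Pt m) → Set
LinDep {k} v = ∃[ c ] (∀ t → lincomb c v t ≡ 0ℚ) × ∃[ i ] c i ≢ 0ℚ

LinDep-head-zero : ∀ {k m} (v : Fin (suc k) → Pt m) → (∀ t → v zero t ≡ 0ℚ) → LinDep v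
LinDep-head-zero {k} {m} v v₀≡0 = c , vanishes , zero , λ ()
  where
  c : Fin (suc k) → ℚ
  c zero = 1ℚ
  c (suc i) = 0ℚ
  vanishes : ∀ t → lincomb c v t ≡ 0ℚ
  vanishes t = trans (cong₂ _+_ (trans (*-identityˡ (v zero t)) (v₀≡0 t))
                                (trans (ΣF-cong (λ i → *-zeroˡ (v (suc i) t))) (ΣF-0 {k})))
                     (+-identityˡ 0ℚ)

module Eliminate {m′} (v : Fin (suc (suc m′)) → Pt (suc m′)) (s : Fin (suc m′)) (v₀s≢0 : v zero s ≢ 0ℚ) where
  factor : Fin (suc m′) → ℚ
  factor i = v (suc i) s * (1/ v zero s) {{≢-nonZero v₀s≢0}}

  reduced : Fin (suc m′) → Pt (suc m′)
  reduced i t = v (suc i) t - factor i * v zero t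

  reduced-pivot : ∀ i → reduced i s ≡ 0ℚ
  reduced-pivot i = begin
    a - (a * p⁻¹) * p     ≡⟨ reassoc a p⁻¹ p ⟩
    a - a * (p⁻¹ * p)     ≡⟨ cong (λ z → a - a * z) (*-inverseˡ (v zero s) {{≢-nonZero v₀s≢0}}) ⟩
    a - a * 1ℚ            ≡⟨ cancel a ⟩
    0ℚ                    ∎
    where
    open ≡-Reasoning
    a = v (suc i) s
    p = v zero s
    p⁻¹ = (1/ v zero s) {{≢-nonZero v₀s≢0}}
    reassoc : ∀ a i p → a - (a * i) * p ≡ a - a * (i * p)
    reassoc = solve-∀ ℚ-ring
    cancel : ∀ a → a - a * 1ℚ ≡ 0ℚ
    cancel = solve-∀ ℚ-ring

  rest : Fin (suc m′) → Pt m′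
  rest i t′ = reduced i (punchIn s t′)

  lift : LinDep rest → LinDep v
  lift (c′ , c′-vanishes , j , c′j≢0) = c , vanishes , suc j , c′j≢0
    where
    S = ΣF (λ i → c′ i * factor i)
    c : Fin (suc (suc m′)) → ℚ
    c zero = - S
    c (suc i) = c′ i
    to-reduced : ∀ t → lincomb c v t ≡ lincomb c′ reduced t
    to-reduced t = begin
      - S * v zero t + ΣF (λ i → c′ i * v (suc i) t)
        ≡⟨ cong (- S * v zero t +_) (ΣF-cong (λ i → split (c′ i) (v (suc i) t) (factor i) (v zero t))) ⟩
      - S * v zero t + ΣF (λ i → c′ i * reduced i t + (c′ i * factor i) * v zero t)
        ≡⟨ cong (- S * v zero t +_) (ΣF-+ (λ i → c′ i * reduced i t) (λ i → (c′ i * factor i) * v zero t)) ⟩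
      - S * v zero t + (lincomb c′ reduced t + ΣF (λ i → (c′ i * factor i) * v zero t))
        ≡⟨ cong (λ z → - S * v zero t + (lincomb c′ reduced t + z)) (ΣF-*ʳ (v zero t) (λ i → c′ i * factor i)) ⟩
      - S * v zero t + (lincomb c′ reduced t + S * v zero t)
        ≡⟨ cancel S (v zero t) (lincomb c′ reduced t) ⟩
      lincomb c′ reduced t ∎
      where
      open ≡-Reasoning
      split : ∀ c a r b → c * a ≡ c * (a - r * b) + (c * r) * b
      split = solve-∀ ℚ-ring
      cancel : ∀ S b U → - S * b + (U + S * b) ≡ U
      cancel = solve-∀ ℚ-ring
    vanishes : ∀ t → lincomb c v t ≡ 0ℚ
    vanishes t with ≡∨punchIn s t
    ... | inj₁ refl = trans (to-reduced s)
                        (trans (ΣF-cong (λ i → trans (cong (c′ i *_) (reduced-pivot i)) (*-zeroʳ (c′ i)))) (ΣF-0 {suc m′}))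
    ... | inj₂ (t′ , refl) = trans (to-reduced (punchIn s t′)) (c′-vanishes t′)

linDep : ∀ m (v : Fin (suc m) → Pt m) → LinDep v
linDep m v with Finₚ.any? (λ s → ¬? (v zero s ≟ 0ℚ))
... | no all-zero = LinDep-head-zero v (λ s → decidable-stable (v zero s ≟ 0ℚ) (λ v₀s≢0 → all-zero (s , v₀s≢0)))
linDep zero v | yes (() , _)
linDep (suc m′) v | yes (s , v₀s≢0) = Eliminate.lift v s v₀s≢0 (linDep m′ (Eliminate.rest v s v₀s≢0))

-- Prepending the coordinate 1 turns an affine dependence into a linear dependence
-- of m + 2 vectors in ℚ^(m+1).
¬AffInd-of-determined : ∀ {m n} (p : Fin (suc (suc m)) → Pt n) (ι : Fin m → Fin n) →
  (∀ c → ΣF c ≡ 0ℚ → (∀ s → lincomb c p (ι s) ≡ 0ℚ) → ∀ t → lincomb c p t ≡ 0ℚ) → ¬ AffInd p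
¬AffInd-of-determined {m} p ι determined p-ind with linDep (suc m) homogenised
  where
  homogenised : Fin (suc (suc m)) → Pt (suc m)
  homogenised i zero = 1ℚ
  homogenised i (suc s) = p i (ι s)
... | c , vanishes , j , cj≢0 = cj≢0 (p-ind c Σc≡0 (determined c Σc≡0 (λ s → vanishes (suc s))) j)
  where
  Σc≡0 : ΣF c ≡ 0ℚ
  Σc≡0 = trans (ΣF-cong (λ i → sym (*-identityʳ (c i)))) (vanishes zero)

AffInd-single : ∀ {n} (p : Fin 1 → Pt n) → AffInd p
AffInd-single p c Σc≡0 _ zero = trans (sym (+-identityʳ (c zero))) Σc≡0

AffInd-extendTop : ∀ {m n} (q : Fin m → Pt n) → AffInd q → AffInd (λ i → extendTop (q i))
AffInd-extendTop {n = n} q q-ind c Σc≡0 vanishes = q-ind c Σc≡0 λ s →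
  trans (ΣF-cong (λ i → cong (c i *_) (sym (snoc-inject₁ (q i) (ℕ→ℚ (suc n)) s)))) (vanishes (inject₁ s))

AffInd-extendBottom : ∀ {m n} (q : Fin m → Pt n) → AffInd q → AffInd (λ i → extendBottom (q i))
AffInd-extendBottom q q-ind c Σc≡0 vanishes = q-ind c Σc≡0 λ s → begin
  lincomb c q s                               ≡⟨ +-identityʳ (lincomb c q s) ⟨
  lincomb c q s + 0ℚ                          ≡⟨ cong (lincomb c q s +_) Σc≡0 ⟨
  lincomb c q s + ΣF c                        ≡⟨ ΣF-+ (λ i → c i * q i s) c ⟨
  ΣF (λ i → c i * q i s + c i)                ≡⟨ ΣF-cong (λ i → trans (distrib (c i) (q i s))
                                                   (cong (c i *_) (sym (snoc-inject₁ (λ j → q i j + 1ℚ) 1ℚ s)))) ⟩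
  lincomb c (λ i → extendBottom (q i)) (inject₁ s) ≡⟨ vanishes (inject₁ s) ⟩
  0ℚ                                          ∎
  where
  open ≡-Reasoning
  distrib : ∀ c a → c * a + c ≡ c * (a + 1ℚ)
  distrib = solve-∀ ℚ-ring

lincomb-snoc-family : ∀ {m n} (c : Fin (suc m) → ℚ) (p : Fin m → Pt n) p₀ t →
  lincomb c (snoc p p₀) t ≡ lincomb (λ j → c (inject₁ j)) p t + c (fromℕ m) * p₀ t
lincomb-snoc-family c p p₀ t = trans (ΣF-init-last (λ j → c j * snoc p p₀ j t))
  (cong₂ _+_ (ΣF-cong (λ j → cong (λ z → c (inject₁ j) * z t) (snoc-inject₁ p p₀ j)))
             (cong (λ z → c (fromℕ _) * z t) (snoc-fromℕ p p₀)))

ℕ→ℚ-weights-cancel : ∀ n′ {s c₀} → s * ℕ→ℚ (suc (suc n′)) + c₀ ≡ 0ℚ → s + c₀ ≡ 0ℚ → s ≡ 0ℚ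
ℕ→ℚ-weights-cancel n′ {s} {c₀} weighted≡0 plain≡0 = ℕ→ℚ-suc-*-cancel n′ (begin
  N * s                                  ≡⟨ difference s c₀ N ⟩
  (s * (1ℚ + N) + c₀) - (s + c₀)         ≡⟨ cong (λ z → (s * z + c₀) - (s + c₀)) (ℕ→ℚ-suc (suc n′)) ⟨
  (s * ℕ→ℚ (suc (suc n′)) + c₀) - (s + c₀) ≡⟨ cong₂ _-_ weighted≡0 plain≡0 ⟩
  0ℚ - 0ℚ                                ≡⟨ +-inverseʳ 0ℚ ⟩
  0ℚ                                     ∎)
  where
  open ≡-Reasoning
  N = ℕ→ℚ (suc n′)
  difference : ∀ s c N → N * s ≡ (s * (1ℚ + N) + c) - (s + c)
  difference = solve-∀ ℚ-ring

-- The new point extendBottom (q zero) has last coordinate 1, all others n + 1, so its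
-- weight in a vanishing affine combination is forced to be 0.
AffInd-extend : ∀ {m n′} (q : Fin (suc m) → Pt (suc n′)) → AffInd q →
  AffInd (snoc (λ i → extendTop (q i)) (extendBottom (q zero)))
AffInd-extend {m} {n′} q q-ind c Σc≡0 vanishes = all-zero
  where
  n = suc n′
  c′ : Fin (suc m) → ℚ
  c′ j = c (inject₁ j)
  c₀ = c (fromℕ (suc m))
  coordinate : ∀ t → lincomb c′ (λ j → extendTop (q j)) t + c₀ * extendBottom (q zero) t ≡ 0ℚ
  coordinate t = trans (sym (lincomb-snoc-family c (λ j → extendTop (q j)) (extendBottom (q zero)) t)) (vanishes t)
  Σc′+c₀≡0 : ΣF c′ + c₀ ≡ 0ℚ
  Σc′+c₀≡0 = trans (sym (ΣF-init-last c)) Σc≡0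
  Σc′≡0 : ΣF c′ ≡ 0ℚ
  Σc′≡0 = ℕ→ℚ-weights-cancel n′ (trans (cong₂ _+_ last-old last-new) (coordinate (fromℕ n))) Σc′+c₀≡0
    where
    last-old : ΣF c′ * ℕ→ℚ (suc n) ≡ lincomb c′ (λ j → extendTop (q j)) (fromℕ n)
    last-old = trans (sym (ΣF-*ʳ (ℕ→ℚ (suc n)) c′)) (ΣF-cong (λ j → cong (c′ j *_) (sym (snoc-fromℕ (q j) (ℕ→ℚ (suc n))))))
    last-new : c₀ ≡ c₀ * extendBottom (q zero) (fromℕ n)
    last-new = trans (sym (*-identityʳ c₀)) (cong (c₀ *_) (sym (snoc-fromℕ (λ j → q zero j + 1ℚ) 1ℚ)))
  c₀≡0 : c₀ ≡ 0ℚ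
  c₀≡0 = trans (sym (+-identityˡ c₀)) (trans (cong (_+ c₀) (sym Σc′≡0)) Σc′+c₀≡0)
  column : ∀ s → lincomb c′ q s ≡ 0ℚ
  column s = begin
    lincomb c′ q s                                   ≡⟨ ΣF-cong (λ j → cong (c′ j *_) (snoc-inject₁ (q j) (ℕ→ℚ (suc n)) s)) ⟨
    lincomb c′ (λ j → extendTop (q j)) (inject₁ s)   ≡⟨ +-identityʳ _ ⟨
    lincomb c′ (λ j → extendTop (q j)) (inject₁ s) + 0ℚ
      ≡⟨ cong (lincomb c′ (λ j → extendTop (q j)) (inject₁ s) +_) (trans (cong (_* b) c₀≡0) (*-zeroˡ b)) ⟨
    lincomb c′ (λ j → extendTop (q j)) (inject₁ s) + c₀ * b ≡⟨ coordinate (inject₁ s) ⟩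
    0ℚ                                               ∎
    where
    open ≡-Reasoning
    b = extendBottom (q zero) (inject₁ s)
  all-zero : ∀ i → c i ≡ 0ℚ
  all-zero i with view i
  ... | ‵fromℕ = c₀≡0
  ... | ‵inj₁ {i = j} _ = q-ind c′ Σc′≡0 column j

IndependentIn : ∀ {n} → (Pt n → Set) → ℕ → Set
IndependentIn {n} A k = Σ (Fin k → Pt n) λ p → (∀ i → A (p i)) × AffInd p

P-independent : ∀ n → IndependentIn (P n) (suc (n ∸ 1))
P-independent zero = (λ _ ()) , (λ _ → P-0 (λ ())) , AffInd-single (λ _ ())
P-independent (suc zero) =
  (λ _ → extendTop {0} (λ ())) , (λ _ → P-extendTop (P-0 (λ ()))) , AffInd-single (λ _ → extendTop {0} (λ ()))
P-independent (suc (suc n′)) with P-independent (suc n′)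
... | q , q∈P , q-ind =
  snoc (λ i → extendTop (q i)) (extendBottom (q zero)) ,
  snoc-All (P (suc (suc n′))) (λ i → P-extendTop (q∈P i)) (P-extendBottom (q∈P zero)) ,
  AffInd-extend q q-ind

dot-lincomb-level : ∀ {m n} (β : Pt n) K (c : Fin m → ℚ) (p : Fin m → Pt n) →
  (∀ i → dot β (p i) ≡ K) → ΣF c ≡ 0ℚ → dot β (lincomb c p) ≡ 0ℚ
dot-lincomb-level β K c p level Σc≡0 = begin
  dot β (lincomb c p)             ≡⟨ dot-lincomb β c p ⟩
  ΣF (λ i → c i * dot β (p i))    ≡⟨ ΣF-cong (λ i → cong (c i *_) (level i)) ⟩
  ΣF (λ i → c i * K)              ≡⟨ ΣF-*ʳ K c ⟩
  ΣF c * K                        ≡⟨ cong (_* K) Σc≡0 ⟩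
  0ℚ * K                          ≡⟨ *-zeroˡ K ⟩
  0ℚ                              ∎
  where open ≡-Reasoning

ΣF-lincomb-P : ∀ {m n} (c : Fin m → ℚ) (p : Fin m → Pt n) → (∀ i → P n (p i)) → ΣF c ≡ 0ℚ → ΣF (lincomb c p) ≡ 0ℚ
ΣF-lincomb-P {n = n} c p p∈P Σc≡0 = trans (ΣF≡dot-1 (lincomb c p))
  (dot-lincomb-level (λ _ → 1ℚ) (ℕ→ℚ (suc n C 2)) c p
    (λ i → trans (sym (ΣF≡dot-1 (p i))) (proj₁ (P⇒Constraints (p∈P i)))) Σc≡0)

P-¬independent : ∀ n → ¬ IndependentIn (P n) (suc (suc (n ∸ 1)))
P-¬independent zero (p , _ , p-ind) = ¬AffInd-of-determined p (λ ()) (λ _ _ _ ()) p-ind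
P-¬independent (suc n′) (p , p∈P , p-ind) = ¬AffInd-of-determined p suc determined p-ind
  where
  determined : ∀ c → ΣF c ≡ 0ℚ → (∀ s → lincomb c p (suc s) ≡ 0ℚ) → ∀ t → lincomb c p t ≡ 0ℚ
  determined c Σc≡0 rest≡0 zero = begin
    lincomb c p zero                                          ≡⟨ +-identityʳ (lincomb c p zero) ⟨
    lincomb c p zero + 0ℚ                                     ≡⟨ cong (lincomb c p zero +_) (trans (ΣF-cong rest≡0) (ΣF-0 {n′})) ⟨
    lincomb c p zero + ΣF (λ s → lincomb c p (suc s))         ≡⟨ ΣF-lincomb-P c p p∈P Σc≡0 ⟩
    0ℚ                                                        ∎
    where open ≡-Reasoning
  determined c Σc≡0 rest≡0 (suc s) = rest≡0 s

-- The facets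

signed : Bool → ℚ → ℚ
signed true q = q
signed false q = - q

signed-involutive : ∀ b {q r} → signed b q ≡ r → q ≡ signed b r
signed-involutive true q≡r = q≡r
signed-involutive false {q} -q≡r = trans (sym (neg-involutive q)) (cong -_ -q≡r)
  where
  neg-involutive : ∀ q → - - q ≡ q
  neg-involutive = solve-∀ ℚ-ring

Face : Bool → ∀ n → Fin n → Pt n → Set
Face b n k x = P n x × (signed b (L k x) ≡ ℕ→ℚ (suc (toℕ k) C 2))

-- On the last facet the last coordinate is extreme: 1 on the upper one, n + 1 on the lower one.
extendFace : Bool → ∀ {n} → Pt n → Pt (suc n)
extendFace true = extendBottom
extendFace false = extendTop

P-extendFace : ∀ b {n} {u} → P n u → P (suc n) (extendFace b u)
P-extendFace true = P-extendBottom
P-extendFace false = P-extendTop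

AffInd-extendFace : ∀ b {m n} (q : Fin m → Pt n) → AffInd q → AffInd (λ i → extendFace b (q i))
AffInd-extendFace true = AffInd-extendBottom
AffInd-extendFace false = AffInd-extendTop

L-extendFace-last : ∀ b {n} (u : Pt n) → ΣF u ≡ ℕ→ℚ (suc n C 2) →
  signed b (L (fromℕ n) (extendFace b u)) ≡ ℕ→ℚ (suc n C 2)
L-extendFace-last true {n} u ΣF≡ = begin
  L (fromℕ n) (extendBottom u)              ≡⟨ L-snoc-fromℕ (λ j → u j + 1ℚ) 1ℚ ⟩
  ΣF (λ j → u j + 1ℚ) - N * 1ℚ              ≡⟨ cong (_- N * 1ℚ) (trans (ΣF-+ u (λ _ → 1ℚ)) (cong (ΣF u +_) (ΣF-const {n} 1ℚ))) ⟩
  ΣF u + N * 1ℚ - N * 1ℚ                    ≡⟨ cancel (ΣF u) N ⟩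
  ΣF u                                      ≡⟨ ΣF≡ ⟩
  ℕ→ℚ (suc n C 2)                           ∎
  where
  open ≡-Reasoning
  N = ℕ→ℚ n
  cancel : ∀ s N → s + N * 1ℚ - N * 1ℚ ≡ s
  cancel = solve-∀ ℚ-ring
L-extendFace-last false {n} u ΣF≡ = begin
  - L (fromℕ n) (extendTop u)               ≡⟨ cong -_ (L-snoc-fromℕ u (ℕ→ℚ (suc n))) ⟩
  - (ΣF u - N * ℕ→ℚ (suc n))                ≡⟨ cong₂ (λ a b → - (a - N * b)) (trans ΣF≡ T≡) (ℕ→ℚ-suc n) ⟩
  - ((N + X) - N * (1ℚ + N))                ≡⟨ regroup X N ⟩
  N * N - X                                 ≡⟨ cong (_- X) double ⟨
  X + X + N - X                             ≡⟨ cancel X N ⟩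
  N + X                                     ≡⟨ T≡ ⟨
  ℕ→ℚ (suc n C 2)                           ∎
  where
  open ≡-Reasoning
  X = ℕ→ℚ (n C 2)
  N = ℕ→ℚ n
  T≡ : ℕ→ℚ (suc n C 2) ≡ N + X
  T≡ = trans (cong ℕ→ℚ (C-suc n)) (ℕ→ℚ-+ n (n C 2))
  double : X + X + N ≡ N * N
  double = trans (sym (trans (ℕ→ℚ-+ (n C 2 ℕ.+ n C 2) n) (cong (_+ N) (ℕ→ℚ-+ (n C 2) (n C 2)))))
             (trans (cong ℕ→ℚ (C-double n)) (ℕ→ℚ-* n n))
  regroup : ∀ X N → - ((N + X) - N * (1ℚ + N)) ≡ N * N - X
  regroup = solve-∀ ℚ-ring
  cancel : ∀ X N → X + X + N - X ≡ N + X
  cancel = solve-∀ ℚ-ring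

Face-base : ∀ b n → IndependentIn (Face b (suc n) (fromℕ n)) (suc (n ∸ 1))
Face-base b n with P-independent n
... | q , q∈P , q-ind =
  (λ i → extendFace b (q i)) ,
  (λ i → P-extendFace b (q∈P i) ,
         subst (λ m → signed b (L (fromℕ n) (extendFace b (q i))) ≡ ℕ→ℚ (suc m C 2)) (sym (Finₚ.toℕ-fromℕ n))
           (L-extendFace-last b (q i) (proj₁ (P⇒Constraints (q∈P i))))) ,
  AffInd-extendFace b q q-ind

Face-extend : ∀ b {n} (k : Fin n) {u} → Face b n k u →
  Face b (suc n) (inject₁ k) (extendTop u) × Face b (suc n) (inject₁ k) (extendBottom u)
Face-extend b {n} k {u} (u∈P , L≡) =
  (P-extendTop u∈P , lift (extendTop u) (trans (cong (signed b) (L-snoc-inject₁ k u (ℕ→ℚ (suc n)))) L≡)) ,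
  (P-extendBottom u∈P ,
    lift (extendBottom u) (trans (cong (signed b) (trans (L-snoc-inject₁ k (λ j → u j + 1ℚ) 1ℚ) (L-shift k u 1ℚ))) L≡))
  where
  lift : ∀ v → signed b (L (inject₁ k) v) ≡ ℕ→ℚ (suc (toℕ k) C 2) →
    signed b (L (inject₁ k) v) ≡ ℕ→ℚ (suc (toℕ (inject₁ k)) C 2)
  lift v = subst (λ m → signed b (L (inject₁ k) v) ≡ ℕ→ℚ (suc m C 2)) (sym (Finₚ.toℕ-inject₁ k))

Face-grow : ∀ b {n₄} (k : Fin (suc (suc n₄))) →
  IndependentIn (Face b (suc (suc n₄)) k) (suc n₄) → IndependentIn (Face b (suc (suc (suc n₄))) (inject₁ k)) (suc (suc n₄))
Face-grow b {n₄} k (q , q∈F , q-ind) =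
  snoc (λ i → extendTop (q i)) (extendBottom (q zero)) ,
  snoc-All (Face b (suc (suc (suc n₄))) (inject₁ k)) (λ i → proj₁ (Face-extend b k (q∈F i))) (proj₂ (Face-extend b k (q∈F zero))) ,
  AffInd-extend q q-ind

Face-step : ∀ b {n₄} (k : Fin (suc (suc (suc n₄)))) → 1 ℕ.≤ toℕ k →
  (∀ k′ → 1 ℕ.≤ toℕ k′ → IndependentIn (Face b (suc (suc n₄)) k′) (suc n₄)) →
  IndependentIn (Face b (suc (suc (suc n₄))) k) (suc (suc n₄))
Face-step b {n₄} k 1≤k smaller with view k
... | ‵fromℕ = Face-base b (suc (suc n₄))
... | ‵inj₁ {i = k′} _ = Face-grow b k′ (smaller k′ (subst (1 ℕ.≤_) (Finₚ.toℕ-inject₁ k′) 1≤k))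

Face-independent : ∀ b n (k : Fin n) → 1 ℕ.≤ toℕ k → IndependentIn (Face b n k) (suc (n ∸ 2))
Face-independent b (suc zero) zero ()
Face-independent b (suc (suc zero)) k 1≤k with view k
... | ‵fromℕ = Face-base b 1
... | ‵inj₁ {i = zero} _ = ⊥-elim (ℕₚ.<-irrefl refl 1≤k)
Face-independent b (suc (suc (suc n₄))) k 1≤k =
  Face-step b k 1≤k (Face-independent b (suc (suc n₄)))

prefix-vanishing : ∀ {n} (f : Fin n → ℚ) k → (∀ i → i ≢ k → f i ≡ 0ℚ) → prefix f (toℕ k) ≡ 0ℚ
prefix-vanishing {n} f k off-k = trans (ΣF-cong term≡0) (ΣF-0 {n})
  where
  if-0 : ∀ b → (if b then 0ℚ else 0ℚ) ≡ 0ℚ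
  if-0 true = refl
  if-0 false = refl
  term≡0 : ∀ i → (if toℕ i <ᵇ toℕ k then f i else 0ℚ) ≡ 0ℚ
  term≡0 i with i Finₚ.≟ k
  ... | yes refl = cong (λ b → if b then f k else 0ℚ) (<ᵇ-false {toℕ k} {toℕ k} ℕₚ.≤-refl)
  ... | no i≢k = trans (if-cong (toℕ i <ᵇ toℕ k) (off-k i i≢k)) (if-0 (toℕ i <ᵇ toℕ k))

ℕ→ℚ-sum-difference-cancel : ∀ j {A B} → A + B ≡ 0ℚ → A - ℕ→ℚ (suc j) * B ≡ 0ℚ → A ≡ 0ℚ × B ≡ 0ℚ
ℕ→ℚ-sum-difference-cancel j {A} {B} sum≡0 difference≡0 = A≡0 , B≡0
  where
  J = ℕ→ℚ (suc j)
  eliminate : ∀ A B J → (1ℚ + J) * B ≡ (A + B) - (A - J * B)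
  eliminate = solve-∀ ℚ-ring
  B≡0 : B ≡ 0ℚ
  B≡0 = ℕ→ℚ-suc-*-cancel (suc j) (begin
    ℕ→ℚ (suc (suc j)) * B    ≡⟨ cong (_* B) (ℕ→ℚ-suc (suc j)) ⟩
    (1ℚ + J) * B             ≡⟨ eliminate A B J ⟩
    (A + B) - (A - J * B)    ≡⟨ cong₂ _-_ sum≡0 difference≡0 ⟩
    0ℚ - 0ℚ                  ≡⟨ +-inverseʳ 0ℚ ⟩
    0ℚ                       ∎)
    where open ≡-Reasoning
  A≡0 : A ≡ 0ℚ
  A≡0 = trans (sym (+-identityʳ A)) (trans (cong (A +_) (sym B≡0)) sum≡0)

-- The coordinate sum and L k pin down the coordinates 0 and k of an affine combination.
Face-determined : ∀ b {m n₂} (k′ : Fin (suc n₂)) (p : Fin m → Pt (suc (suc n₂))) →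
  (∀ i → Face b (suc (suc n₂)) (suc k′) (p i)) → ∀ c → ΣF c ≡ 0ℚ →
  (∀ s → lincomb c p (suc (punchIn k′ s)) ≡ 0ℚ) → ∀ t → lincomb c p t ≡ 0ℚ
Face-determined b k′ p p∈F c Σc≡0 others≡0 = all-zero
  where
  k = suc k′
  z = lincomb c p
  A = z zero
  B = z k
  J = ℕ→ℚ (suc (toℕ k′))
  off-k : ∀ i → i ≢ k′ → z (suc i) ≡ 0ℚ
  off-k i i≢k′ with ≡∨punchIn k′ i
  ... | inj₁ i≡k′ = ⊥-elim (i≢k′ i≡k′)
  ... | inj₂ (s , refl) = others≡0 s
  A+B≡0 : A + B ≡ 0ℚ
  A+B≡0 = trans (cong (A +_) (sym (ΣF-single (λ i → z (suc i)) k′ off-k)))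
                (ΣF-lincomb-P c p (λ i → proj₁ (p∈F i)) Σc≡0)
  L≡0 : L k z ≡ 0ℚ
  L≡0 = trans (L≡dot-α k z) (dot-lincomb-level (α k) (signed b (ℕ→ℚ (suc (toℕ k) C 2))) c p
    (λ i → trans (sym (L≡dot-α k (p i))) (signed-involutive b (proj₂ (p∈F i)))) Σc≡0)
  L≡A-JB : L k z ≡ A - J * B
  L≡A-JB = trans (L≡prefix k z) (cong (λ a → a - J * B)
    (trans (cong (A +_) (prefix-vanishing (λ i → z (suc i)) k′ off-k)) (+-identityʳ A)))
  A≡0∧B≡0 : A ≡ 0ℚ × B ≡ 0ℚ
  A≡0∧B≡0 = ℕ→ℚ-sum-difference-cancel (toℕ k′) A+B≡0 (trans (sym L≡A-JB) L≡0)
  all-zero : ∀ t → z t ≡ 0ℚ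
  all-zero zero = proj₁ A≡0∧B≡0
  all-zero (suc t) with t Finₚ.≟ k′
  ... | yes refl = proj₂ A≡0∧B≡0
  ... | no t≢k′ = off-k t t≢k′

Face-¬independent : ∀ b n (k : Fin n) → 1 ℕ.≤ toℕ k → ¬ IndependentIn (Face b n k) (suc (suc (n ∸ 2)))
Face-¬independent b (suc n) zero ()
Face-¬independent b (suc zero) (suc ())
Face-¬independent b (suc (suc n₂)) (suc k′) _ (p , p∈F , p-ind) =
  ¬AffInd-of-determined p (λ s → suc (punchIn k′ s)) (Face-determined b k′ p p∈F) p-ind

-- Orthogonality of the facet normals

ΣF-indicator-< : ∀ {n} j → j ℕ.≤ n → ΣF {n} (λ i → indicator (toℕ i <ᵇ j)) ≡ ℕ→ℚ j
ΣF-indicator-< {n} zero _ = ΣF-0 {n}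
ΣF-indicator-< {suc n} (suc j) (ℕ.s≤s j≤n) = trans (cong (1ℚ +_) (ΣF-indicator-< {n} j j≤n)) (sym (ℕ→ℚ-suc j))

ΣF-α : ∀ {n} (k : Fin n) → ΣF (α k) ≡ 0ℚ
ΣF-α {n} k = begin
  ΣF (α k)                             ≡⟨ ΣF-- below (λ i → K * at i) ⟩
  ΣF below - ΣF (λ i → K * at i)       ≡⟨ cong₂ _-_ (ΣF-indicator-< (toℕ k) (ℕₚ.<⇒≤ (Finₚ.toℕ<n k))) (ΣF-*ˡ K at) ⟩
  K - K * ΣF at                        ≡⟨ cong (λ z → K - K * z) ΣF-at ⟩
  K - K * 1ℚ                           ≡⟨ cancel K ⟩
  0ℚ                                   ∎
  where
  open ≡-Reasoning
  K = ℕ→ℚ (toℕ k)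
  below at : Fin n → ℚ
  below i = indicator (toℕ i <ᵇ toℕ k)
  at i = indicator (toℕ i ≡ᵇ toℕ k)
  ΣF-at : ΣF at ≡ 1ℚ
  ΣF-at = trans (ΣF-cong (λ i → sym (*-identityʳ (at i)))) (dot-indicator-≡ᵇ k (λ _ → 1ℚ))
  cancel : ∀ K → K - K * 1ℚ ≡ 0ℚ
  cancel = solve-∀ ℚ-ring

-- α k is supported on indices ≤ k, where α l equals 1 when k < l.
α-*-α : ∀ {n} (k l : Fin n) → toℕ k ℕ.< toℕ l → ∀ i → α k i * α l i ≡ α k i
α-*-α k l k<l i with ℕₚ.≤-<-connex (toℕ i) (toℕ k)
... | inj₁ i≤k = trans (cong (α k i *_) αl≡1) (*-identityʳ (α k i))
  where
  i<l = ℕₚ.≤-<-trans i≤k k<l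
  cancel : ∀ L → 1ℚ - L * 0ℚ ≡ 1ℚ
  cancel = solve-∀ ℚ-ring
  αl≡1 : α l i ≡ 1ℚ
  αl≡1 = trans (cong₂ (λ a d → a - ℕ→ℚ (toℕ l) * d) (cong indicator (<ᵇ-true {toℕ i} {toℕ l} i<l))
                       (cong indicator (≡ᵇ-false {toℕ i} {toℕ l} (λ eq → ℕₚ.<-irrefl eq i<l))))
               (cancel (ℕ→ℚ (toℕ l)))
... | inj₂ k<i = trans (cong (_* α l i) αk≡0) (trans (*-zeroˡ (α l i)) (sym αk≡0))
  where
  cancel : ∀ K → 0ℚ - K * 0ℚ ≡ 0ℚ
  cancel = solve-∀ ℚ-ring
  αk≡0 : α k i ≡ 0ℚ
  αk≡0 = trans (cong₂ (λ a d → a - ℕ→ℚ (toℕ k) * d) (cong indicator (<ᵇ-false {toℕ i} {toℕ k} (ℕₚ.<⇒≤ k<i)))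
                       (cong indicator (≡ᵇ-false {toℕ i} {toℕ k} (λ eq → ℕₚ.<-irrefl (sym eq) k<i))))
               (cancel (ℕ→ℚ (toℕ k)))

L-e : ∀ {n} (k i : Fin n) → L k (e i) ≡ α k i
L-e k i = begin
  L k (e i)                     ≡⟨ L≡dot-α k (e i) ⟩
  dot (α k) (e i)               ≡⟨ ΣF-single (λ t → α k t * e i t) i off-i ⟩
  α k i * e i i                 ≡⟨ cong (α k i *_) e-ii ⟩
  α k i * 1ℚ                    ≡⟨ *-identityʳ (α k i) ⟩
  α k i                         ∎
  where
  open ≡-Reasoning
  e-ii : e i i ≡ 1ℚ
  e-ii rewrite ≡ᵇ-true {toℕ i} refl = refl
  off-i : ∀ t → t ≢ i → α k t * e i t ≡ 0ℚ
  off-i t t≢i rewrite ≡ᵇ-false {toℕ i} {toℕ t} (λ eq → t≢i (sym (Finₚ.toℕ-injective eq))) = *-zeroʳ (α k t)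

L-orthogonal : ∀ {n} (k l : Fin n) → k ≢ l → ΣF (λ i → L k (e i) * L l (e i)) ≡ 0ℚ
L-orthogonal k l k≢l with ℕₚ.<-cmp (toℕ k) (toℕ l)
... | tri< k<l _ _ = trans (ΣF-cong (λ i → trans (cong₂ _*_ (L-e k i) (L-e l i)) (α-*-α k l k<l i))) (ΣF-α k)
... | tri≈ _ k≡l _ = ⊥-elim (k≢l (Finₚ.toℕ-injective k≡l))
... | tri> _ _ l<k = trans (ΣF-cong (λ i → trans (cong₂ _*_ (L-e k i) (L-e l i))
                            (trans (*-comm (α k i) (α l i)) (α-*-α l k l<k i)))) (ΣF-α l)

proposition3p4 : (n : ℕ) →
    ((x : Pt n) → P n x ⇔ ((ΣF x ≡ ℕ→ℚ (suc n C 2))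
        × ((k : Fin n) → 1 Data.Nat.≤ toℕ k → ∣ L k x ∣ ≤ ℕ→ℚ (suc (toℕ k) C 2))))
    × HasDim (P n) (n ∸ 1)
    × ((k : Fin n) → 1 Data.Nat.≤ toℕ k →
        HasDim (Face⁺ n k) (n ∸ 2) × HasDim (Face⁻ n k) (n ∸ 2))
    × ((k l : Fin n) → 1 Data.Nat.≤ toℕ k → 1 Data.Nat.≤ toℕ l → k ≢ l →
        ΣF (λ i → L k (e i) * L l (e i)) ≡ 0ℚ)
proposition3p4 n =
  (λ x → mk⇔ P⇒Constraints (Constraints⇒P n)) ,
  (P-independent n , P-¬independent n) ,
  (λ k 1≤k → (Face-independent true n k 1≤k , Face-¬independent true n k 1≤k) ,
             (Face-independent false n k 1≤k , Face-¬independent false n k 1≤k)) ,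
  (λ k l _ _ → L-orthogonal k l)
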